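{- Let $T_{\not\exists}$ be a set of $\exists$-free formulas and $A(\underline{z},\underline{w})$ an $\exists$-free formula of $\mathcal{L}^\omega_*$ whose only free variables are among $\underline{z},\underline{w}$. If $$\mathrm{IL}^{\omega}_*+\mathrm{AC}^{\omega}_*+\mathrm{IP}^*_{\not\exists}+T_{\not\exists}\vdash\forall\underline{z}\exists\underline{w}\,A(\underline{z},\underline{w}),$$ then there exist closed terms $\underline{r}$ such that $$\mathrm{IL}^{\omega}_*+T_{\not\exists}\vdash\forall\underline{z}\exists\underline{w}\in\underline{r}\underline{z}\,A(\underline{z},\underline{w}).$$
   Context: Fix a first-order language $\mathcal{L}$ with at least one constant symbol. Types: $G$; $\sigma\to\tau$; $\sigma^*$. Constants: function symbols of $\mathcal{L}$; $\Pi_{\sigma,\tau}:\sigma\to\tau\to\sigma$; $\Sigma_{\rho,\sigma,\tau}:(\rho\to\sigma\to\tau)\to(\rho\to\sigma)\to\rho\to\tau$; $\mathfrak{s}_\sigma:\sigma\to\sigma^*$; $\cup_\sigma:\sigma^*\to\sigma^*\to\sigma^*$; $\bigcup_{\sigma,\tau}:\sigma^*\to(\sigma\to\tau^*)\to\tau^*$. Terms: constants, typed variables, applications. Atomic formulas: $\bot$, $t=_\rho q$, $t\in_\rho q$ ($q:\rho^*$), $R(t_1,\dots,t_n)$. Formulas of $\mathcal{L}^\omega_*$: closed under $\lor,\land,\to,\forall x,\exists x$ and bounded quantifiers $\forall x\in t,\exists x\in t$. A formula is $\exists$-free if it contains no unbounded $\exists x$. $\mathrm{IL}^{\omega}_*$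 is intuitionistic predicate logic in all finite types with: $x=x$; $x=y\land A\to A'$ ($A$ atomic); $\forall x\in t\,A\leftrightarrow\forall x(x\in t\to A)$; $\exists x\in t\,A\leftrightarrow\exists x(x\in t\land A)$; $\Sigma xyz=xz(yz)$; $\Pi xy=x$; $w\in\mathfrak{s}x\leftrightarrow w=x$; $w\in\cup xy\leftrightarrow w\in x\lor w\in y$; $z\in x\land w\in yz\to w\in\bigcup xy$; $\bigcup(\mathfrak{s}x)y=yx$; $\bigcup(\cup xy)z=\cup(\bigcup xz)(\bigcup yz)$. $\mathrm{AC}^{\omega}_*$: $\forall x^\rho\exists y^\sigma A(x,y)\to\exists f^{\rho\to\sigma^*}\forall x\exists y\in fx\,A(x,y)$. $\mathrm{IP}^*_{\not\exists}$: $(B(x)\to\exists y\,A(y))\to\exists w(B(x)\to\exists y\in w\,A(y))$ for $\exists$-free $B$. For tuples, $\exists\underline{w}\in\underline{r}\underline{z}$ means $\exists w_1\in r_1\underline{z}\cdots\exists w_k\in r_k\underline{z}$. -}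

module Defs where

open import Data.Nat using (ℕ; zero; suc)
open import Data.List using (List; []; _∷_; map)
open import Data.List.Membership.Propositional using (_∈_)
open import Data.List.Relation.Unary.All using (All; []; _∷_)
import Data.List.Relation.Unary.All as All
open import Data.Vec using (Vec)
import Data.Vec as Vec
open import Data.Product using (Σ; _×_; _,_)
open import Data.Sum using (_⊎_)
open import Relation.Binary.PropositionalEquality using (_≡_)

record Language : Set₁ where
  field
    FunSym   : Set
    funArity : FunSym → ℕ
    RelSym   : Set
    relArity : RelSym → ℕ
    aConst      : FunSym
    aConstArity : funArity aConst ≡ 0

infixr 30 _⇒_
infix 40 _*
data Ty : Set where
  G   : Ty
  _⇒_ : Ty → Ty → Ty
  _*  : Ty → Ty

arityTy : ℕ → Ty
arityTy zero    = G
arityTy (suc n) = G ⇒ arityTy n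

Ctx : Set
Ctx = List Ty

data _∋_ : Ctx → Ty → Set where
  vz : ∀ {Γ σ} → (σ ∷ Γ) ∋ σ
  vs : ∀ {Γ σ τ} → Γ ∋ σ → (τ ∷ Γ) ∋ σ

-- telescope extension, Δ listed outermost-first
_,,_ : Ctx → List Ty → Ctx
Γ ,, []      = Γ
Γ ,, (σ ∷ Δ) = (σ ∷ Γ) ,, Δ

_⇒*_ : List Ty → Ty → Ty
[] ⇒* τ      = τ
(σ ∷ Δ) ⇒* τ = σ ⇒ (Δ ⇒* τ)

Ren : Ctx → Ctx → Set
Ren Γ Δ = ∀ {σ} → Γ ∋ σ → Δ ∋ σ

liftR : ∀ {Γ Δ τ} → Ren Γ Δ → Ren (τ ∷ Γ) (τ ∷ Δ)
liftR ρ vz     = vz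
liftR ρ (vs x) = vs (ρ x)

emptyR : ∀ {Γ} → Ren [] Γ
emptyR ()

module Syntax (L : Language) where
  open Language L

  data Const : Ty → Set where
    fun    : (f : FunSym) → Const (arityTy (funArity f))
    Πc     : ∀ σ τ → Const (σ ⇒ τ ⇒ σ)
    Σc     : ∀ ρ σ τ → Const ((ρ ⇒ σ ⇒ τ) ⇒ (ρ ⇒ σ) ⇒ ρ ⇒ τ)
    sng    : ∀ σ → Const (σ ⇒ σ *)
    cup    : ∀ σ → Const (σ * ⇒ σ * ⇒ σ *)
    bigcup : ∀ σ τ → Const (σ * ⇒ (σ ⇒ τ *) ⇒ τ *)

  data Tm (Γ : Ctx) : Ty → Set where
    var : ∀ {σ} → Γ ∋ σ → Tm Γ σ
    con : ∀ {σ} → Const σ → Tm Γ σ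
    app : ∀ {σ τ} → Tm Γ (σ ⇒ τ) → Tm Γ σ → Tm Γ τ

  infixr 6 _∧'_
  infixr 5 _∨'_
  infixr 4 _⇒'_
  data Fm (Γ : Ctx) : Set where
    ⊥'    : Fm Γ
    eq    : ∀ {ρ} → Tm Γ ρ → Tm Γ ρ → Fm Γ
    mem   : ∀ {ρ} → Tm Γ ρ → Tm Γ (ρ *) → Fm Γ
    rel   : (R : RelSym) → Vec (Tm Γ G) (relArity R) → Fm Γ
    _∨'_  : Fm Γ → Fm Γ → Fm Γ
    _∧'_  : Fm Γ → Fm Γ → Fm Γ
    _⇒'_  : Fm Γ → Fm Γ → Fm Γ
    ∀'    : (σ : Ty) → Fm (σ ∷ Γ) → Fm Γ
    ∃'    : (σ : Ty) → Fm (σ ∷ Γ) → Fm Γ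
    ∀∈    : ∀ {σ} → Tm Γ (σ *) → Fm (σ ∷ Γ) → Fm Γ
    ∃∈    : ∀ {σ} → Tm Γ (σ *) → Fm (σ ∷ Γ) → Fm Γ

  _⇔'_ : ∀ {Γ} → Fm Γ → Fm Γ → Fm Γ
  A ⇔' B = (A ⇒' B) ∧' (B ⇒' A)

  data Atomic {Γ : Ctx} : Fm Γ → Set where
    at-⊥   : Atomic ⊥'
    at-eq  : ∀ {ρ} (t q : Tm Γ ρ) → Atomic (eq t q)
    at-mem : ∀ {ρ} (t : Tm Γ ρ) (q : Tm Γ (ρ *)) → Atomic (mem t q)
    at-rel : ∀ R ts → Atomic (rel R ts)

  data ExFree {Γ : Ctx} : Fm Γ → Set where
    ef-at  : ∀ {A} → Atomic A → ExFree A
    ef-∨   : ∀ {A B} → ExFree A → ExFree B → ExFree (A ∨' B)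
    ef-∧   : ∀ {A B} → ExFree A → ExFree B → ExFree (A ∧' B)
    ef-⇒   : ∀ {A B} → ExFree A → ExFree B → ExFree (A ⇒' B)
    ef-∀   : ∀ {σ A} → ExFree {σ ∷ Γ} A → ExFree (∀' σ A)
    ef-∀∈  : ∀ {σ} {t : Tm Γ (σ *)} {A} → ExFree {σ ∷ Γ} A → ExFree (∀∈ t A)
    ef-∃∈  : ∀ {σ} {t : Tm Γ (σ *)} {A} → ExFree {σ ∷ Γ} A → ExFree (∃∈ t A)

  renT : ∀ {Γ Δ σ} → Ren Γ Δ → Tm Γ σ → Tm Δ σ
  renT ρ (var x)   = var (ρ x)
  renT ρ (con c)   = con c
  renT ρ (app t u) = app (renT ρ t) (renT ρ u)

  renF : ∀ {Γ Δ} → Ren Γ Δ → Fm Γ → Fm Δ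
  renF ρ ⊥'        = ⊥'
  renF ρ (eq t q)  = eq (renT ρ t) (renT ρ q)
  renF ρ (mem t q) = mem (renT ρ t) (renT ρ q)
  renF ρ (rel R ts) = rel R (Vec.map (renT ρ) ts)
  renF ρ (A ∨' B)  = renF ρ A ∨' renF ρ B
  renF ρ (A ∧' B)  = renF ρ A ∧' renF ρ B
  renF ρ (A ⇒' B)  = renF ρ A ⇒' renF ρ B
  renF ρ (∀' σ A)  = ∀' σ (renF (liftR ρ) A)
  renF ρ (∃' σ A)  = ∃' σ (renF (liftR ρ) A)
  renF ρ (∀∈ t A)  = ∀∈ (renT ρ t) (renF (liftR ρ) A)
  renF ρ (∃∈ t A)  = ∃∈ (renT ρ t) (renF (liftR ρ) A)

  wkT : ∀ {Γ σ τ} → Tm Γ σ → Tm (τ ∷ Γ) σ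
  wkT = renT vs

  wkF : ∀ {Γ τ} → Fm Γ → Fm (τ ∷ Γ)
  wkF = renF vs

  Sub : Ctx → Ctx → Set
  Sub Γ Δ = ∀ {σ} → Γ ∋ σ → Tm Δ σ

  liftS : ∀ {Γ Δ τ} → Sub Γ Δ → Sub (τ ∷ Γ) (τ ∷ Δ)
  liftS s vz     = var vz
  liftS s (vs x) = wkT (s x)

  subT : ∀ {Γ Δ σ} → Sub Γ Δ → Tm Γ σ → Tm Δ σ
  subT s (var x)   = s x
  subT s (con c)   = con c
  subT s (app t u) = app (subT s t) (subT s u)

  subF : ∀ {Γ Δ} → Sub Γ Δ → Fm Γ → Fm Δ
  subF s ⊥'         = ⊥'
  subF s (eq t q)   = eq (subT s t) (subT s q)
  subF s (mem t q)  = mem (subT s t) (subT s q)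
  subF s (rel R ts) = rel R (Vec.map (subT s) ts)
  subF s (A ∨' B)   = subF s A ∨' subF s B
  subF s (A ∧' B)   = subF s A ∧' subF s B
  subF s (A ⇒' B)   = subF s A ⇒' subF s B
  subF s (∀' σ A)   = ∀' σ (subF (liftS s) A)
  subF s (∃' σ A)   = ∃' σ (subF (liftS s) A)
  subF s (∀∈ t A)   = ∀∈ (subT s t) (subF (liftS s) A)
  subF s (∃∈ t A)   = ∃∈ (subT s t) (subF (liftS s) A)

  single : ∀ {Γ σ} → Tm Γ σ → Sub (σ ∷ Γ) Γ
  single t vz     = t
  single t (vs x) = var x

  _[_] : ∀ {Γ σ} → Fm (σ ∷ Γ) → Tm Γ σ → Fm Γ
  A [ t ] = subF (single t) A

  Axioms : Set₁
  Axioms = (Γ : Ctx) → Fm Γ → Set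

  _⊕_ : Axioms → Axioms → Axioms
  (X ⊕ Y) Γ A = X Γ A ⊎ Y Γ A

  data _∣_⊢_ (Ax : Axioms) {Γ : Ctx} (Hs : List (Fm Γ)) : Fm Γ → Set where
    hyp  : ∀ {A} → A ∈ Hs → Ax ∣ Hs ⊢ A
    ax   : ∀ {A} → Ax Γ A → Ax ∣ Hs ⊢ A
    ⊥E   : ∀ {A} → Ax ∣ Hs ⊢ ⊥' → Ax ∣ Hs ⊢ A
    ∧I   : ∀ {A B} → Ax ∣ Hs ⊢ A → Ax ∣ Hs ⊢ B → Ax ∣ Hs ⊢ (A ∧' B)
    ∧E₁  : ∀ {A B} → Ax ∣ Hs ⊢ (A ∧' B) → Ax ∣ Hs ⊢ A
    ∧E₂  : ∀ {A B} → Ax ∣ Hs ⊢ (A ∧' B) → Ax ∣ Hs ⊢ B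
    ∨I₁  : ∀ {A B} → Ax ∣ Hs ⊢ A → Ax ∣ Hs ⊢ (A ∨' B)
    ∨I₂  : ∀ {A B} → Ax ∣ Hs ⊢ B → Ax ∣ Hs ⊢ (A ∨' B)
    ∨E   : ∀ {A B C} → Ax ∣ Hs ⊢ (A ∨' B) → Ax ∣ (A ∷ Hs) ⊢ C
           → Ax ∣ (B ∷ Hs) ⊢ C → Ax ∣ Hs ⊢ C
    ⇒I   : ∀ {A B} → Ax ∣ (A ∷ Hs) ⊢ B → Ax ∣ Hs ⊢ (A ⇒' B)
    ⇒E   : ∀ {A B} → Ax ∣ Hs ⊢ (A ⇒' B) → Ax ∣ Hs ⊢ A → Ax ∣ Hs ⊢ B
    ∀I   : ∀ {σ A} → _∣_⊢_ Ax {σ ∷ Γ} (map wkF Hs) A → Ax ∣ Hs ⊢ ∀' σ A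
    ∀E   : ∀ {σ A} → Ax ∣ Hs ⊢ ∀' σ A → (t : Tm Γ σ) → Ax ∣ Hs ⊢ (A [ t ])
    ∃I   : ∀ {σ A} (t : Tm Γ σ) → Ax ∣ Hs ⊢ (A [ t ]) → Ax ∣ Hs ⊢ ∃' σ A
    ∃E   : ∀ {σ A C} → Ax ∣ Hs ⊢ ∃' σ A
           → _∣_⊢_ Ax {σ ∷ Γ} (A ∷ map wkF Hs) (wkF C) → Ax ∣ Hs ⊢ C

  -- Axioms of IL^ω_* (schemata; free variables instantiated by terms,
  -- which is equivalent to taking universal closures)

  c : ∀ {Γ σ} → Const σ → Tm Γ σ
  c = con

  _·_ : ∀ {Γ σ τ} → Tm Γ (σ ⇒ τ) → Tm Γ σ → Tm Γ τ
  _·_ = app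
  infixl 9 _·_

  data ILAx : Axioms where
    refl-ax  : ∀ {Γ ρ} (x : Tm Γ ρ) → ILAx Γ (eq x x)
    subst-ax : ∀ {Γ ρ} (A : Fm (ρ ∷ Γ)) → Atomic A → (x y : Tm Γ ρ)
               → ILAx Γ ((eq x y ∧' (A [ x ])) ⇒' (A [ y ]))
    ∀∈-ax    : ∀ {Γ σ} (t : Tm Γ (σ *)) (A : Fm (σ ∷ Γ))
               → ILAx Γ (∀∈ t A ⇔' ∀' σ (mem (var vz) (wkT t) ⇒' A))
    ∃∈-ax    : ∀ {Γ σ} (t : Tm Γ (σ *)) (A : Fm (σ ∷ Γ))
               → ILAx Γ (∃∈ t A ⇔' ∃' σ (mem (var vz) (wkT t) ∧' A))
    Σ-ax     : ∀ {Γ ρ σ τ} (x : Tm Γ (ρ ⇒ σ ⇒ τ)) (y : Tm Γ (ρ ⇒ σ)) (z : Tm Γ ρ)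
               → ILAx Γ (eq (c (Σc ρ σ τ) · x · y · z) (x · z · (y · z)))
    Π-ax     : ∀ {Γ σ τ} (x : Tm Γ σ) (y : Tm Γ τ)
               → ILAx Γ (eq (c (Πc σ τ) · x · y) x)
    sng-ax   : ∀ {Γ σ} (w x : Tm Γ σ)
               → ILAx Γ (mem w (c (sng σ) · x) ⇔' eq w x)
    cup-ax   : ∀ {Γ σ} (w : Tm Γ σ) (x y : Tm Γ (σ *))
               → ILAx Γ (mem w (c (cup σ) · x · y) ⇔' (mem w x ∨' mem w y))
    bigcup-ax : ∀ {Γ σ τ} (x : Tm Γ (σ *)) (y : Tm Γ (σ ⇒ τ *)) (z : Tm Γ σ) (w : Tm Γ τ)
               → ILAx Γ ((mem z x ∧' mem w (y · z)) ⇒' mem w (c (bigcup σ τ) · x · y))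
    bigcup-sng-ax : ∀ {Γ σ τ} (x : Tm Γ σ) (y : Tm Γ (σ ⇒ τ *))
               → ILAx Γ (eq (c (bigcup σ τ) · (c (sng σ) · x) · y) (y · x))
    bigcup-cup-ax : ∀ {Γ σ τ} (x y : Tm Γ (σ *)) (z : Tm Γ (σ ⇒ τ *))
               → ILAx Γ (eq (c (bigcup σ τ) · (c (cup σ) · x · y) · z)
                            (c (cup τ) · (c (bigcup σ τ) · x · z) · (c (bigcup σ τ) · y · z)))

  data ACAx : Axioms where
    ac : ∀ {Γ ρ σ} (A : Fm (σ ∷ ρ ∷ Γ))
         → ACAx Γ (∀' ρ (∃' σ A)
                   ⇒' ∃' (ρ ⇒ σ *) (∀' ρ (∃∈ (var (vs vz) · var vz)
                                               (renF (liftR (liftR vs)) A))))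

  data IPAx : Axioms where
    ip : ∀ {Γ σ} (B : Fm Γ) → ExFree B → (A : Fm (σ ∷ Γ))
         → IPAx Γ ((B ⇒' ∃' σ A)
                   ⇒' ∃' (σ *) (wkF B ⇒' ∃∈ (var vz) (renF (liftR vs) A)))

  data TAx (T : Fm [] → Set) : Axioms where
    tax : ∀ {Γ} {B : Fm []} → T B → TAx T Γ (renF emptyR B)

  ∀* : ∀ {Γ} (Δ : List Ty) → Fm (Γ ,, Δ) → Fm Γ
  ∀* []      A = A
  ∀* (σ ∷ Δ) A = ∀' σ (∀* Δ A)

  ∃* : ∀ {Γ} (Δ : List Ty) → Fm (Γ ,, Δ) → Fm Γ
  ∃* []      A = A
  ∃* (σ ∷ Δ) A = ∃' σ (∃* Δ A)

  ∃∈* : ∀ {Γ} (Δ : List Ty) → All (λ σ → Tm Γ (σ *)) Δ → Fm (Γ ,, Δ) → Fm Γ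
  ∃∈* []      []       A = A
  ∃∈* (σ ∷ Δ) (t ∷ ts) A = ∃∈ t (∃∈* Δ (All.map wkT ts) A)

  apps : ∀ {Γ τ} (Δ : List Ty) → Tm Γ (Δ ⇒* τ) → Tm (Γ ,, Δ) τ
  apps []      t = t
  apps (σ ∷ Δ) t = apps Δ (wkT t · var vz)

-- Formulas are interpreted by a Kripke-style forcing relation whose worlds are contexts of
-- variables with hypotheses, derivations being taken in IL^ω_* + T.  An existential ∃w A is
-- forced by a bound W : σ* and a formula P selecting witnesses, with Hs ⊢ ∃w∈W P and A forced
-- once w and P w are assumed; a disjunction by a derivable case split.  On ∃-free formulas
-- forcing coincides with derivability, so the axioms of T and the ∃-free premise of IP can be
-- used as hypotheses, and AC holds because a bound W(x) depending on x gives the choice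
-- function λx.W(x) with the singleton bound {λx.W(x)}.  Forcing is closed under the rules of
-- natural deduction; the eliminations of ∨ and ∃ rest on the locality of forcing along
-- derivable case splits and bounded existentials, where the bounds arising in different
-- cases are merged with ∪ and ⋃.  Forcing ∀z∃w A at the generic world z yields bounds U(z),
-- and bracket abstraction with Σ and Π turns them into closed terms r with r z = U(z).

module Submission where

open import Defs
open import Data.List using (List; []; _∷_; map)
open import Data.List.Properties using (map-∘; map-cong)
open import Data.List.Membership.Propositional.Properties using (∈-map⁺)
open import Data.List.Relation.Binary.Subset.Propositional using (_⊆_)
open import Data.List.Relation.Binary.Subset.Propositional.Properties
  using (∷⁺ʳ) renaming (map⁺ to ⊆-map⁺)
open import Data.List.Relation.Unary.Any using (here; there)
open import Data.List.Relation.Unary.All using (All; []; _∷_)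
import Data.List.Relation.Unary.All as All
import Data.List.Relation.Unary.All.Properties as All
import Data.Vec.Properties as Vec
open import Data.Product using (Σ; _×_; _,_; proj₁; proj₂)
open import Data.Sum using (inj₁; inj₂)
open import Function using (id; _∘′_)
open import Relation.Binary.PropositionalEquality hiding ([_])
open ≡-Reasoning

module Substitution (L : Language) where
  open Syntax L

  infixr 5 _▸_
  _▸_ : ∀ {Γ Δ τ} → Tm Δ τ → Sub Γ Δ → Sub (τ ∷ Γ) Δ
  (t ▸ θ) vz     = t
  (t ▸ θ) (vs x) = θ x

  infixr 9 _∘s_
  _∘s_ : ∀ {Γ Δ Δ'} → Sub Δ Δ' → Sub Γ Δ → Sub Γ Δ'
  (σ ∘s θ) x = subT σ (θ x)

  ids : ∀ {Γ} → Sub Γ Γ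
  ids = var

  toSub : ∀ {Γ Δ} → Ren Γ Δ → Sub Γ Δ
  toSub ρ x = var (ρ x)

  ↑ : ∀ {Γ τ} → Sub Γ (τ ∷ Γ)
  ↑ = toSub vs

  infix 4 _≐_
  _≐_ : ∀ {Γ Δ} → Sub Γ Δ → Sub Γ Δ → Set
  θ ≐ θ' = ∀ {σ} (x : _ ∋ σ) → θ x ≡ θ' x

  ≐-sym : ∀ {Γ Δ} {θ θ' : Sub Γ Δ} → θ ≐ θ' → θ' ≐ θ
  ≐-sym h x = sym (h x)

  ▸-≐ : ∀ {Γ Δ τ} (t : Tm Δ τ) {θ θ' : Sub Γ Δ} → θ ≐ θ' → t ▸ θ ≐ t ▸ θ'
  ▸-≐ t h vz     = refl
  ▸-≐ t h (vs x) = h x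

  ∘s-≐ : ∀ {Γ Δ Δ'} (σ : Sub Δ Δ') {θ θ' : Sub Γ Δ} → θ ≐ θ' → σ ∘s θ ≐ σ ∘s θ'
  ∘s-≐ σ h x = cong (subT σ) (h x)

  subT-≐ : ∀ {Γ Δ σ} {θ θ' : Sub Γ Δ} → θ ≐ θ' → (t : Tm Γ σ) → subT θ t ≡ subT θ' t
  subT-≐ h (var x)   = h x
  subT-≐ h (con k)   = refl
  subT-≐ h (app t u) = cong₂ app (subT-≐ h t) (subT-≐ h u)

  renT≡subT : ∀ {Γ Δ σ} (ρ : Ren Γ Δ) (t : Tm Γ σ) → renT ρ t ≡ subT (toSub ρ) t
  renT≡subT ρ (var x)   = refl
  renT≡subT ρ (con k)   = refl
  renT≡subT ρ (app t u) = cong₂ app (renT≡subT ρ t) (renT≡subT ρ u)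

  subT-∘ : ∀ {Γ Δ Δ' σ} (σ' : Sub Δ Δ') (θ : Sub Γ Δ) (t : Tm Γ σ) →
           subT σ' (subT θ t) ≡ subT (σ' ∘s θ) t
  subT-∘ σ' θ (var x)   = refl
  subT-∘ σ' θ (con k)   = refl
  subT-∘ σ' θ (app t u) = cong₂ app (subT-∘ σ' θ t) (subT-∘ σ' θ u)

  subT-ids : ∀ {Γ σ} (t : Tm Γ σ) → subT ids t ≡ t
  subT-ids (var x)   = refl
  subT-ids (con k)   = refl
  subT-ids (app t u) = cong₂ app (subT-ids t) (subT-ids u)

  ∘s-assoc : ∀ {Γ Δ Δ' Δ''} (σ' : Sub Δ' Δ'') (σ : Sub Δ Δ') (θ : Sub Γ Δ) →
             (σ' ∘s σ) ∘s θ ≐ σ' ∘s (σ ∘s θ)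
  ∘s-assoc σ' σ θ x = sym (subT-∘ σ' σ (θ x))

  ids-∘s : ∀ {Γ Δ} (θ : Sub Γ Δ) → ids ∘s θ ≐ θ
  ids-∘s θ x = subT-ids (θ x)

  wkT≡subT-↑ : ∀ {Γ σ τ} (t : Tm Γ σ) → wkT {τ = τ} t ≡ subT ↑ t
  wkT≡subT-↑ = renT≡subT vs

  subT-wkT : ∀ {Γ Δ σ τ} (σ' : Sub (τ ∷ Γ) Δ) (t : Tm Γ σ) → subT σ' (wkT t) ≡ subT (σ' ∘s ↑) t
  subT-wkT σ' t = trans (cong (subT σ') (wkT≡subT-↑ t)) (subT-∘ σ' ↑ t)

  wkT-subT : ∀ {Γ Δ σ τ} (θ : Sub Γ Δ) (t : Tm Γ σ) →
             wkT {τ = τ} (subT θ t) ≡ subT (λ x → wkT (θ x)) t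
  wkT-subT θ t = begin
    wkT (subT θ t)         ≡⟨ wkT≡subT-↑ (subT θ t) ⟩
    subT ↑ (subT θ t)      ≡⟨ subT-∘ ↑ θ t ⟩
    subT (↑ ∘s θ) t        ≡⟨ subT-≐ (λ x → sym (wkT≡subT-↑ (θ x))) t ⟩
    subT (λ x → wkT (θ x)) t ∎

  liftS-wkT : ∀ {Γ Δ σ τ} (θ : Sub Γ Δ) (t : Tm Γ σ) →
              subT (liftS {τ = τ} θ) (wkT t) ≡ wkT (subT θ t)
  liftS-wkT θ t = trans (subT-wkT (liftS θ) t) (sym (wkT-subT θ t))

  single-wkT : ∀ {Γ σ τ} (u : Tm Γ τ) (t : Tm Γ σ) → subT (single u) (wkT t) ≡ t
  single-wkT u t = trans (subT-wkT (single u) t) (subT-ids t)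

  liftS-≐ : ∀ {Γ Δ τ} {θ θ' : Sub Γ Δ} → θ ≐ θ' → liftS {τ = τ} θ ≐ liftS θ'
  liftS-≐ h vz     = refl
  liftS-≐ h (vs x) = cong wkT (h x)

  subF-≐ : ∀ {Γ Δ} {θ θ' : Sub Γ Δ} → θ ≐ θ' → (A : Fm Γ) → subF θ A ≡ subF θ' A
  subF-≐ h ⊥'         = refl
  subF-≐ h (eq t q)   = cong₂ eq (subT-≐ h t) (subT-≐ h q)
  subF-≐ h (mem t q)  = cong₂ mem (subT-≐ h t) (subT-≐ h q)
  subF-≐ h (rel R ts) = cong (rel R) (Vec.map-cong (subT-≐ h) ts)
  subF-≐ h (A ∨' B)   = cong₂ _∨'_ (subF-≐ h A) (subF-≐ h B)
  subF-≐ h (A ∧' B)   = cong₂ _∧'_ (subF-≐ h A) (subF-≐ h B)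
  subF-≐ h (A ⇒' B)   = cong₂ _⇒'_ (subF-≐ h A) (subF-≐ h B)
  subF-≐ h (∀' σ A)   = cong (∀' σ) (subF-≐ (liftS-≐ h) A)
  subF-≐ h (∃' σ A)   = cong (∃' σ) (subF-≐ (liftS-≐ h) A)
  subF-≐ h (∀∈ t A)   = cong₂ ∀∈ (subT-≐ h t) (subF-≐ (liftS-≐ h) A)
  subF-≐ h (∃∈ t A)   = cong₂ ∃∈ (subT-≐ h t) (subF-≐ (liftS-≐ h) A)

  toSub-liftR : ∀ {Γ Δ τ} (ρ : Ren Γ Δ) → toSub (liftR {τ = τ} ρ) ≐ liftS (toSub ρ)
  toSub-liftR ρ vz     = refl
  toSub-liftR ρ (vs x) = refl

  renF≡subF-lift : ∀ {Γ Δ τ} (ρ : Ren Γ Δ) (A : Fm (τ ∷ Γ)) →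
                   renF (liftR ρ) A ≡ subF (liftS (toSub ρ)) A

  renF≡subF : ∀ {Γ Δ} (ρ : Ren Γ Δ) (A : Fm Γ) → renF ρ A ≡ subF (toSub ρ) A
  renF≡subF ρ ⊥'         = refl
  renF≡subF ρ (eq t q)   = cong₂ eq (renT≡subT ρ t) (renT≡subT ρ q)
  renF≡subF ρ (mem t q)  = cong₂ mem (renT≡subT ρ t) (renT≡subT ρ q)
  renF≡subF ρ (rel R ts) = cong (rel R) (Vec.map-cong (renT≡subT ρ) ts)
  renF≡subF ρ (A ∨' B)   = cong₂ _∨'_ (renF≡subF ρ A) (renF≡subF ρ B)
  renF≡subF ρ (A ∧' B)   = cong₂ _∧'_ (renF≡subF ρ A) (renF≡subF ρ B)
  renF≡subF ρ (A ⇒' B)   = cong₂ _⇒'_ (renF≡subF ρ A) (renF≡subF ρ B)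
  renF≡subF ρ (∀' σ A)   = cong (∀' σ) (renF≡subF-lift ρ A)
  renF≡subF ρ (∃' σ A)   = cong (∃' σ) (renF≡subF-lift ρ A)
  renF≡subF ρ (∀∈ t A)   = cong₂ ∀∈ (renT≡subT ρ t) (renF≡subF-lift ρ A)
  renF≡subF ρ (∃∈ t A)   = cong₂ ∃∈ (renT≡subT ρ t) (renF≡subF-lift ρ A)

  renF≡subF-lift ρ A = trans (renF≡subF (liftR ρ) A) (subF-≐ (toSub-liftR ρ) A)

  liftS-∘ : ∀ {Γ Δ Δ' τ} (σ' : Sub Δ Δ') (θ : Sub Γ Δ) →
            liftS {τ = τ} σ' ∘s liftS θ ≐ liftS (σ' ∘s θ)
  liftS-∘ σ' θ vz     = refl
  liftS-∘ σ' θ (vs x) = liftS-wkT σ' (θ x)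

  subF-∘-lift : ∀ {Γ Δ Δ' τ} (σ' : Sub Δ Δ') (θ : Sub Γ Δ) (A : Fm (τ ∷ Γ)) →
                subF (liftS σ') (subF (liftS θ) A) ≡ subF (liftS (σ' ∘s θ)) A
  subF-∘ : ∀ {Γ Δ Δ'} (σ' : Sub Δ Δ') (θ : Sub Γ Δ) (A : Fm Γ) →
           subF σ' (subF θ A) ≡ subF (σ' ∘s θ) A
  subF-∘ σ' θ ⊥'         = refl
  subF-∘ σ' θ (eq t q)   = cong₂ eq (subT-∘ σ' θ t) (subT-∘ σ' θ q)
  subF-∘ σ' θ (mem t q)  = cong₂ mem (subT-∘ σ' θ t) (subT-∘ σ' θ q)
  subF-∘ σ' θ (rel R ts) = cong (rel R)
    (trans (sym (Vec.map-∘ (subT σ') (subT θ) ts)) (Vec.map-cong (subT-∘ σ' θ) ts))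
  subF-∘ σ' θ (A ∨' B)   = cong₂ _∨'_ (subF-∘ σ' θ A) (subF-∘ σ' θ B)
  subF-∘ σ' θ (A ∧' B)   = cong₂ _∧'_ (subF-∘ σ' θ A) (subF-∘ σ' θ B)
  subF-∘ σ' θ (A ⇒' B)   = cong₂ _⇒'_ (subF-∘ σ' θ A) (subF-∘ σ' θ B)
  subF-∘ σ' θ (∀' σ A)   = cong (∀' σ) (subF-∘-lift σ' θ A)
  subF-∘ σ' θ (∃' σ A)   = cong (∃' σ) (subF-∘-lift σ' θ A)
  subF-∘ σ' θ (∀∈ t A)   = cong₂ ∀∈ (subT-∘ σ' θ t) (subF-∘-lift σ' θ A)
  subF-∘ σ' θ (∃∈ t A)   = cong₂ ∃∈ (subT-∘ σ' θ t) (subF-∘-lift σ' θ A)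

  subF-∘-lift σ' θ A = trans (subF-∘ (liftS σ') (liftS θ) A) (subF-≐ (liftS-∘ σ' θ) A)

  subF-∘-≐ : ∀ {Γ Δ Δ'} (σ' : Sub Δ Δ') (θ : Sub Γ Δ) {η : Sub Γ Δ'} →
             σ' ∘s θ ≐ η → (A : Fm Γ) → subF σ' (subF θ A) ≡ subF η A
  subF-∘-≐ σ' θ h A = trans (subF-∘ σ' θ A) (subF-≐ h A)

  liftS-ids : ∀ {Γ τ} → liftS {τ = τ} (ids {Γ}) ≐ ids
  liftS-ids vz     = refl
  liftS-ids (vs x) = refl

  subF-ids-lift : ∀ {Γ τ} (A : Fm (τ ∷ Γ)) → subF (liftS ids) A ≡ A
  subF-ids : ∀ {Γ} (A : Fm Γ) → subF ids A ≡ A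
  subF-ids ⊥'         = refl
  subF-ids (eq t q)   = cong₂ eq (subT-ids t) (subT-ids q)
  subF-ids (mem t q)  = cong₂ mem (subT-ids t) (subT-ids q)
  subF-ids (rel R ts) = cong (rel R) (trans (Vec.map-cong subT-ids ts) (Vec.map-id ts))
  subF-ids (A ∨' B)   = cong₂ _∨'_ (subF-ids A) (subF-ids B)
  subF-ids (A ∧' B)   = cong₂ _∧'_ (subF-ids A) (subF-ids B)
  subF-ids (A ⇒' B)   = cong₂ _⇒'_ (subF-ids A) (subF-ids B)
  subF-ids (∀' σ A)   = cong (∀' σ) (subF-ids-lift A)
  subF-ids (∃' σ A)   = cong (∃' σ) (subF-ids-lift A)
  subF-ids (∀∈ t A)   = cong₂ ∀∈ (subT-ids t) (subF-ids-lift A)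
  subF-ids (∃∈ t A)   = cong₂ ∃∈ (subT-ids t) (subF-ids-lift A)

  subF-ids-lift A = trans (subF-≐ liftS-ids A) (subF-ids A)

  wkF≡subF-↑ : ∀ {Γ τ} (A : Fm Γ) → wkF {τ = τ} A ≡ subF ↑ A
  wkF≡subF-↑ = renF≡subF vs

  subF-wkF : ∀ {Γ Δ τ} (σ : Sub (τ ∷ Γ) Δ) (A : Fm Γ) → subF σ (wkF A) ≡ subF (σ ∘s ↑) A
  subF-wkF σ A = trans (cong (subF σ) (wkF≡subF-↑ A)) (subF-∘ σ ↑ A)

  wkF-subF : ∀ {Γ Δ τ} (θ : Sub Γ Δ) (A : Fm Γ) → wkF {τ = τ} (subF θ A) ≡ subF (↑ ∘s θ) A
  wkF-subF θ A = trans (wkF≡subF-↑ (subF θ A)) (subF-∘ ↑ θ A)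

  liftS-wkF : ∀ {Γ Δ τ} (θ : Sub Γ Δ) (A : Fm Γ) →
              subF (liftS {τ = τ} θ) (wkF A) ≡ wkF (subF θ A)
  liftS-wkF θ A = begin
    subF (liftS θ) (wkF A)  ≡⟨ subF-wkF (liftS θ) A ⟩
    subF (liftS θ ∘s ↑) A   ≡⟨ subF-≐ (λ x → wkT≡subT-↑ (θ x)) A ⟩
    subF (↑ ∘s θ) A         ≡⟨ wkF-subF θ A ⟨
    wkF (subF θ A)          ∎

  single-liftS : ∀ {Γ Δ τ} (t : Tm Δ τ) (θ : Sub Γ Δ) → single t ∘s liftS θ ≐ t ▸ θ
  single-liftS t θ vz     = refl
  single-liftS t θ (vs x) = single-wkT t (θ x)

  subT-liftS-single : ∀ {Γ Δ τ ρ} (θ : Sub Γ Δ) (t : Tm (τ ∷ Γ) ρ) (u : Tm Δ τ) →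
                      subT (single u) (subT (liftS θ) t) ≡ subT (u ▸ θ) t
  subT-liftS-single θ t u = trans (subT-∘ (single u) (liftS θ) t) (subT-≐ (single-liftS u θ) t)

  subF-liftS-single : ∀ {Γ Δ τ} (θ : Sub Γ Δ) (A : Fm (τ ∷ Γ)) (t : Tm Δ τ) →
                      subF (liftS θ) A [ t ] ≡ subF (t ▸ θ) A
  subF-liftS-single θ A t = subF-∘-≐ (single t) (liftS θ) (single-liftS t θ) A

  subF-single : ∀ {Γ Δ τ} (θ : Sub Γ Δ) (A : Fm (τ ∷ Γ)) (t : Tm Γ τ) →
                subF θ (A [ t ]) ≡ subF (liftS θ) A [ subT θ t ]
  subF-single θ A t = begin
    subF θ (A [ t ])                  ≡⟨ subF-∘-≐ θ (single t) θ∘single A ⟩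
    subF (subT θ t ▸ θ) A             ≡⟨ subF-liftS-single θ A (subT θ t) ⟨
    subF (liftS θ) A [ subT θ t ]     ∎
    where
    θ∘single : θ ∘s single t ≐ subT θ t ▸ θ
    θ∘single vz     = refl
    θ∘single (vs x) = refl

  renF-single : ∀ {Γ Δ τ} (ρ : Ren Γ Δ) (A : Fm (τ ∷ Γ)) (t : Tm Γ τ) →
                renF ρ (A [ t ]) ≡ renF (liftR ρ) A [ renT ρ t ]
  renF-single ρ A t = begin
    renF ρ (A [ t ])                             ≡⟨ renF≡subF ρ (A [ t ]) ⟩
    subF (toSub ρ) (A [ t ])                     ≡⟨ subF-single (toSub ρ) A t ⟩
    subF (liftS (toSub ρ)) A [ subT (toSub ρ) t ] ≡⟨ cong₂ _[_] (renF≡subF-lift ρ A) (renT≡subT ρ t) ⟨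
    renF (liftR ρ) A [ renT ρ t ]                ∎

  renF-liftR-wkF : ∀ {Γ Δ τ} (ρ : Ren Γ Δ) (A : Fm Γ) →
                   renF (liftR {τ = τ} ρ) (wkF A) ≡ wkF (renF ρ A)
  renF-liftR-wkF ρ A = begin
    renF (liftR ρ) (wkF A)           ≡⟨ renF≡subF-lift ρ (wkF A) ⟩
    subF (liftS (toSub ρ)) (wkF A)   ≡⟨ liftS-wkF (toSub ρ) A ⟩
    wkF (subF (toSub ρ) A)           ≡⟨ cong wkF (renF≡subF ρ A) ⟨
    wkF (renF ρ A)                   ∎

  single-vz-liftR : ∀ {Γ τ} (A : Fm (τ ∷ Γ)) → renF (liftR {τ = τ} vs) A [ var vz ] ≡ A
  single-vz-liftR A = begin
    renF (liftR vs) A [ var vz ]            ≡⟨ cong _[ var vz ] (renF≡subF-lift vs A) ⟩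
    subF (liftS ↑) A [ var vz ]             ≡⟨ subF-liftS-single ↑ A (var vz) ⟩
    subF (var vz ▸ ↑) A                     ≡⟨ subF-≐ vz▸↑ A ⟩
    subF ids A                              ≡⟨ subF-ids A ⟩
    A                                       ∎
    where
    vz▸↑ : var vz ▸ ↑ ≐ ids
    vz▸↑ vz     = refl
    vz▸↑ (vs x) = refl

  vz▸↑∘s : ∀ {Γ Δ τ} (θ : Sub Γ Δ) → var vz ▸ (↑ {τ = τ} ∘s θ) ≐ liftS θ
  vz▸↑∘s θ vz     = refl
  vz▸↑∘s θ (vs x) = sym (wkT≡subT-↑ (θ x))

  subF-∘-lift-single : ∀ {Γ Δ Δ' τ} (σ : Sub Δ Δ') (θ : Sub Γ Δ) (A : Fm (τ ∷ Γ)) (t : Tm Δ' τ) →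
                       subF (liftS σ) (subF (liftS θ) A) [ t ] ≡ subF (t ▸ (σ ∘s θ)) A
  subF-∘-lift-single σ θ A t =
    trans (cong _[ t ] (subF-∘-lift σ θ A)) (subF-liftS-single (σ ∘s θ) A t)

  subT-∘-assoc : ∀ {Γ Γ' Δ Δ' ρ} (σ : Sub Δ Δ') (θ : Sub Γ' Δ) (s : Sub Γ Γ') (t : Tm Γ ρ) →
                 subT (σ ∘s (θ ∘s s)) t ≡ subT (σ ∘s θ) (subT s t)
  subT-∘-assoc σ θ s t = trans (subT-≐ (≐-sym (∘s-assoc σ θ s)) t) (sym (subT-∘ (σ ∘s θ) s t))

  renT-liftR-wkT : ∀ {Γ Δ σ τ} (ρ : Ren Γ Δ) (t : Tm Γ σ) → renT (liftR {τ = τ} ρ) (wkT t) ≡ wkT (renT ρ t)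
  renT-liftR-wkT ρ (var x)   = refl
  renT-liftR-wkT ρ (con k)   = refl
  renT-liftR-wkT ρ (app t u) = cong₂ app (renT-liftR-wkT ρ t) (renT-liftR-wkT ρ u)

  subT-∘∘-≐ : ∀ {Γ₀ Γ₁ Γ₂ Γ₃ ρ} (s₁ : Sub Γ₂ Γ₃) (s₂ : Sub Γ₁ Γ₂) (s₃ : Sub Γ₀ Γ₁) {η : Sub Γ₀ Γ₃} →
              s₁ ∘s s₂ ∘s s₃ ≐ η → (t : Tm Γ₀ ρ) → subT s₁ (subT s₂ (subT s₃ t)) ≡ subT η t
  subT-∘∘-≐ s₁ s₂ s₃ h t =
    trans (cong (subT s₁) (subT-∘ s₂ s₃ t)) (trans (subT-∘ s₁ (s₂ ∘s s₃) t) (subT-≐ h t))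

  subF-∘∘-≐ : ∀ {Γ₀ Γ₁ Γ₂ Γ₃} (s₁ : Sub Γ₂ Γ₃) (s₂ : Sub Γ₁ Γ₂) (s₃ : Sub Γ₀ Γ₁) {η : Sub Γ₀ Γ₃} →
              s₁ ∘s s₂ ∘s s₃ ≐ η → (A : Fm Γ₀) → subF s₁ (subF s₂ (subF s₃ A)) ≡ subF η A
  subF-∘∘-≐ s₁ s₂ s₃ h A = trans (cong (subF s₁) (subF-∘ s₂ s₃ A)) (subF-∘-≐ s₁ (s₂ ∘s s₃) h A)

  swap : ∀ {Δ τ τ₂} → Sub (τ₂ ∷ τ ∷ Δ) (τ ∷ τ₂ ∷ Δ)
  swap vz           = var (vs vz)
  swap (vs vz)      = var vz
  swap (vs (vs x))  = var (vs (vs x))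

  ↑² : ∀ {Δ τ τ₂} → Sub Δ (τ₂ ∷ τ ∷ Δ)
  ↑² x = var (vs (vs x))

  wkT²≡subT-↑² : ∀ {Δ τ τ₂ ρ} (t : Tm Δ ρ) → wkT {τ = τ₂} (wkT {τ = τ} t) ≡ subT ↑² t
  wkT²≡subT-↑² t = begin
    wkT (wkT t)              ≡⟨ wkT≡subT-↑ (wkT t) ⟩
    subT ↑ (wkT t)           ≡⟨ subT-wkT ↑ t ⟩
    subT ↑² t                ∎

  subT-vs-vz▸↑² : ∀ {Δ τ τ₂ ρ} (t : Tm (τ ∷ Δ) ρ) → subT (var (vs vz) ▸ ↑² {τ₂ = τ₂}) t ≡ wkT t
  subT-vs-vz▸↑² t = trans (subT-≐ vs-vz▸↑² t) (sym (wkT≡subT-↑ t))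
    where
    vs-vz▸↑² : var (vs vz) ▸ ↑² ≐ ↑
    vs-vz▸↑² vz     = refl
    vs-vz▸↑² (vs x) = refl

  liftS* : ∀ {Γ Δ} (zs : List Ty) → Sub Γ Δ → Sub (Γ ,, zs) (Δ ,, zs)
  liftS* []       θ = θ
  liftS* (σ ∷ zs) θ = liftS* zs (liftS θ)

  liftS*-ids : ∀ {Γ} (zs : List Ty) → liftS* zs (ids {Γ}) ≐ ids
  liftS*-ids zs = go zs (λ x → refl)
    where
    go : ∀ {Γ} (zs : List Ty) {θ : Sub Γ Γ} → θ ≐ ids → liftS* zs θ ≐ ids
    go []       h = h
    go (σ ∷ zs) h = go zs (λ x → trans (liftS-≐ h x) (liftS-ids x))

module Derivations (L : Language) (T : Syntax.Fm L [] → Set) where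
  open Syntax L
  open Substitution L public

  infix 3 _⊢_
  _⊢_ : ∀ {Γ} → List (Fm Γ) → Fm Γ → Set
  Hs ⊢ A = (ILAx ⊕ TAx T) ∣ Hs ⊢ A

  cast : ∀ {Γ} {Hs : List (Fm Γ)} {A B : Fm Γ} → A ≡ B → Hs ⊢ A → Hs ⊢ B
  cast = subst (_ ⊢_)

  atomic-subF : ∀ {Γ Δ} (θ : Sub Γ Δ) {A : Fm Γ} → Atomic A → Atomic (subF θ A)
  atomic-subF θ at-⊥          = at-⊥
  atomic-subF θ (at-eq t q)   = at-eq _ _
  atomic-subF θ (at-mem t q)  = at-mem _ _
  atomic-subF θ (at-rel R ts) = at-rel R _

  axiom-subF : ∀ {Γ Δ} (θ : Sub Γ Δ) {A : Fm Γ} → (ILAx ⊕ TAx T) Γ A → (ILAx ⊕ TAx T) Δ (subF θ A)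
  axiom-subF θ (inj₁ (refl-ax x))  = inj₁ (refl-ax _)
  axiom-subF θ (inj₁ (subst-ax A at x y)) =
    inj₁ (subst₂ (λ B C → ILAx _ ((eq (subT θ x) (subT θ y) ∧' B) ⇒' C))
                 (sym (subF-single θ A x)) (sym (subF-single θ A y))
                 (subst-ax (subF (liftS θ) A) (atomic-subF (liftS θ) at) (subT θ x) (subT θ y)))
  axiom-subF θ (inj₁ (∀∈-ax t A)) =
    inj₁ (subst (λ u → ILAx _ (∀∈ (subT θ t) B ⇔' ∀' _ (mem (var vz) u ⇒' B)))
                (sym (liftS-wkT θ t)) (∀∈-ax (subT θ t) B))
    where B = subF (liftS θ) A
  axiom-subF θ (inj₁ (∃∈-ax t A)) =
    inj₁ (subst (λ u → ILAx _ (∃∈ (subT θ t) B ⇔' ∃' _ (mem (var vz) u ∧' B)))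
                (sym (liftS-wkT θ t)) (∃∈-ax (subT θ t) B))
    where B = subF (liftS θ) A
  axiom-subF θ (inj₁ (Σ-ax x y z))           = inj₁ (Σ-ax _ _ _)
  axiom-subF θ (inj₁ (Π-ax x y))             = inj₁ (Π-ax _ _)
  axiom-subF θ (inj₁ (sng-ax w x))           = inj₁ (sng-ax _ _)
  axiom-subF θ (inj₁ (cup-ax w x y))         = inj₁ (cup-ax _ _ _)
  axiom-subF θ (inj₁ (bigcup-ax x y z w))    = inj₁ (bigcup-ax _ _ _ _)
  axiom-subF θ (inj₁ (bigcup-sng-ax x y))    = inj₁ (bigcup-sng-ax _ _)
  axiom-subF θ (inj₁ (bigcup-cup-ax x y z))  = inj₁ (bigcup-cup-ax _ _ _)
  axiom-subF θ (inj₂ (tax {B = B} B∈T))      = inj₂ (subst (TAx T _) (sym closed) (tax B∈T))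
    where
    closed : subF θ (renF emptyR B) ≡ renF emptyR B
    closed = begin
      subF θ (renF emptyR B)               ≡⟨ cong (subF θ) (renF≡subF emptyR B) ⟩
      subF θ (subF (toSub emptyR) B)       ≡⟨ subF-∘-≐ θ (toSub emptyR) (λ ()) B ⟩
      subF (toSub emptyR) B                ≡⟨ renF≡subF emptyR B ⟨
      renF emptyR B                        ∎

  ⊢-⊆ : ∀ {Γ} {Hs Hs' : List (Fm Γ)} {A} → Hs ⊆ Hs' → Hs ⊢ A → Hs' ⊢ A
  ⊢-⊆ f (hyp p)       = hyp (f p)
  ⊢-⊆ f (ax a)        = ax a
  ⊢-⊆ f (⊥E d)        = ⊥E (⊢-⊆ f d)
  ⊢-⊆ f (∧I d e)      = ∧I (⊢-⊆ f d) (⊢-⊆ f e)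
  ⊢-⊆ f (∧E₁ d)       = ∧E₁ (⊢-⊆ f d)
  ⊢-⊆ f (∧E₂ d)       = ∧E₂ (⊢-⊆ f d)
  ⊢-⊆ f (∨I₁ d)       = ∨I₁ (⊢-⊆ f d)
  ⊢-⊆ f (∨I₂ d)       = ∨I₂ (⊢-⊆ f d)
  ⊢-⊆ f (∨E d e₁ e₂)  = ∨E (⊢-⊆ f d) (⊢-⊆ (∷⁺ʳ _ f) e₁) (⊢-⊆ (∷⁺ʳ _ f) e₂)
  ⊢-⊆ f (⇒I d)        = ⇒I (⊢-⊆ (∷⁺ʳ _ f) d)
  ⊢-⊆ f (⇒E d e)      = ⇒E (⊢-⊆ f d) (⊢-⊆ f e)
  ⊢-⊆ f (∀I d)        = ∀I (⊢-⊆ (⊆-map⁺ wkF f) d)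
  ⊢-⊆ f (∀E d t)      = ∀E (⊢-⊆ f d) t
  ⊢-⊆ f (∃I t d)      = ∃I t (⊢-⊆ f d)
  ⊢-⊆ f (∃E d e)      = ∃E (⊢-⊆ f d) (⊢-⊆ (∷⁺ʳ _ (⊆-map⁺ wkF f)) e)

  weaken : ∀ {Γ} {Hs : List (Fm Γ)} {A B} → Hs ⊢ B → (A ∷ Hs) ⊢ B
  weaken = ⊢-⊆ there

  map-renF-liftR-wkF : ∀ {Γ Δ τ} (ρ : Ren Γ Δ) (Hs : List (Fm Γ)) →
                       map (renF (liftR {τ = τ} ρ)) (map wkF Hs) ≡ map wkF (map (renF ρ) Hs)
  map-renF-liftR-wkF ρ Hs = begin
    map (renF (liftR ρ)) (map wkF Hs)   ≡⟨ map-∘ Hs ⟨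
    map (renF (liftR ρ) ∘′ wkF) Hs      ≡⟨ map-cong (renF-liftR-wkF ρ) Hs ⟩
    map (wkF ∘′ renF ρ) Hs              ≡⟨ map-∘ Hs ⟩
    map wkF (map (renF ρ) Hs)           ∎

  ⊢-renF : ∀ {Γ Δ} (ρ : Ren Γ Δ) {Hs : List (Fm Γ)} {A} → Hs ⊢ A → map (renF ρ) Hs ⊢ renF ρ A
  ⊢-renF ρ (hyp p)      = hyp (∈-map⁺ (renF ρ) p)
  ⊢-renF ρ (ax {A = A} a) = ax (subst ((ILAx ⊕ TAx T) _) (sym (renF≡subF ρ A)) (axiom-subF (toSub ρ) a))
  ⊢-renF ρ (⊥E d)       = ⊥E (⊢-renF ρ d)
  ⊢-renF ρ (∧I d e)     = ∧I (⊢-renF ρ d) (⊢-renF ρ e)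
  ⊢-renF ρ (∧E₁ d)      = ∧E₁ (⊢-renF ρ d)
  ⊢-renF ρ (∧E₂ d)      = ∧E₂ (⊢-renF ρ d)
  ⊢-renF ρ (∨I₁ d)      = ∨I₁ (⊢-renF ρ d)
  ⊢-renF ρ (∨I₂ d)      = ∨I₂ (⊢-renF ρ d)
  ⊢-renF ρ (∨E d e₁ e₂) = ∨E (⊢-renF ρ d) (⊢-renF ρ e₁) (⊢-renF ρ e₂)
  ⊢-renF ρ (⇒I d)       = ⇒I (⊢-renF ρ d)
  ⊢-renF ρ (⇒E d e)     = ⇒E (⊢-renF ρ d) (⊢-renF ρ e)
  ⊢-renF ρ {Hs} (∀I d)  = ∀I (subst (_⊢ _) (map-renF-liftR-wkF ρ Hs) (⊢-renF (liftR ρ) d))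
  ⊢-renF ρ (∀E {A = A} d t) = cast (sym (renF-single ρ A t)) (∀E (⊢-renF ρ d) (renT ρ t))
  ⊢-renF ρ (∃I {A = A} t d) = ∃I (renT ρ t) (cast (renF-single ρ A t) (⊢-renF ρ d))
  ⊢-renF ρ {Hs} (∃E {A = A} {C = C} d e) =
    ∃E (⊢-renF ρ d)
       (subst₂ (λ Ks B → (renF (liftR ρ) A ∷ Ks) ⊢ B)
               (map-renF-liftR-wkF ρ Hs) (renF-liftR-wkF ρ C) (⊢-renF (liftR ρ) e))

  ⊢-wkF : ∀ {Γ τ} {Hs : List (Fm Γ)} {A} → Hs ⊢ A → map (wkF {τ = τ}) Hs ⊢ wkF A
  ⊢-wkF = ⊢-renF vs

  Mor : ∀ {Γ Δ} → List (Fm Δ) → Sub Γ Δ → List (Fm Γ) → Set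
  Mor Hs' θ Hs = All (λ H → Hs' ⊢ subF θ H) Hs

  Mor-weaken : ∀ {Γ Δ} {Hs' : List (Fm Δ)} {θ : Sub Γ Δ} {Hs} {X} → Mor Hs' θ Hs → Mor (X ∷ Hs') θ Hs
  Mor-weaken = All.map weaken

  Mor-liftS : ∀ {Γ Δ τ} {Hs' : List (Fm Δ)} {θ : Sub Γ Δ} {Hs} →
              Mor Hs' θ Hs → Mor (map wkF Hs') (liftS {τ = τ} θ) (map wkF Hs)
  Mor-liftS {Hs = []}                []       = []
  Mor-liftS {θ = θ} {Hs = H ∷ Hs} (m ∷ ms) = cast (sym (liftS-wkF θ H)) (⊢-wkF m) ∷ Mor-liftS ms

  Mor-∷ : ∀ {Γ Δ} {Hs' : List (Fm Δ)} {θ : Sub Γ Δ} {Hs} {X} →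
          Mor Hs' θ Hs → Mor (subF θ X ∷ Hs') θ (X ∷ Hs)
  Mor-∷ m = hyp (here refl) ∷ Mor-weaken m

  ⊢-subF : ∀ {Γ Δ} (θ : Sub Γ Δ) {Hs : List (Fm Γ)} {Hs' : List (Fm Δ)} {A} →
           Mor Hs' θ Hs → Hs ⊢ A → Hs' ⊢ subF θ A
  ⊢-subF θ m (hyp p)      = All.lookup m p
  ⊢-subF θ m (ax a)       = ax (axiom-subF θ a)
  ⊢-subF θ m (⊥E d)       = ⊥E (⊢-subF θ m d)
  ⊢-subF θ m (∧I d e)     = ∧I (⊢-subF θ m d) (⊢-subF θ m e)
  ⊢-subF θ m (∧E₁ d)      = ∧E₁ (⊢-subF θ m d)
  ⊢-subF θ m (∧E₂ d)      = ∧E₂ (⊢-subF θ m d)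
  ⊢-subF θ m (∨I₁ d)      = ∨I₁ (⊢-subF θ m d)
  ⊢-subF θ m (∨I₂ d)      = ∨I₂ (⊢-subF θ m d)
  ⊢-subF θ m (∨E d e₁ e₂) = ∨E (⊢-subF θ m d) (⊢-subF θ (Mor-∷ m) e₁) (⊢-subF θ (Mor-∷ m) e₂)
  ⊢-subF θ m (⇒I d)       = ⇒I (⊢-subF θ (Mor-∷ m) d)
  ⊢-subF θ m (⇒E d e)     = ⇒E (⊢-subF θ m d) (⊢-subF θ m e)
  ⊢-subF θ m (∀I d)       = ∀I (⊢-subF (liftS θ) (Mor-liftS m) d)
  ⊢-subF θ m (∀E {A = A} d t) = cast (sym (subF-single θ A t)) (∀E (⊢-subF θ m d) (subT θ t))
  ⊢-subF θ m (∃I {A = A} t d) = ∃I (subT θ t) (cast (subF-single θ A t) (⊢-subF θ m d))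
  ⊢-subF θ m (∃E {C = C} d e) =
    ∃E (⊢-subF θ m d) (cast (liftS-wkF θ C) (⊢-subF (liftS θ) (Mor-∷ (Mor-liftS m)) e))

  Mor-∘ : ∀ {Γ Δ Δ'} {Hs : List (Fm Γ)} {Hs' : List (Fm Δ)} {Hs'' : List (Fm Δ')}
          {σ : Sub Γ Δ} {σ' : Sub Δ Δ'} → Mor Hs' σ Hs → Mor Hs'' σ' Hs' → Mor Hs'' (σ' ∘s σ) Hs
  Mor-∘ {σ = σ} {σ'} m m' = All.map (λ {H} d → cast (subF-∘ σ' σ H) (⊢-subF σ' m' d)) m

  Mor-ids : ∀ {Δ} {Hs Hs' : List (Fm Δ)} → All (Hs' ⊢_) Hs → Mor Hs' ids Hs
  Mor-ids = All.map (λ {H} d → cast (sym (subF-ids H)) d)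

  Mor-⊆ : ∀ {Δ} {Hs Hs' : List (Fm Δ)} → Hs ⊆ Hs' → Mor Hs' ids Hs
  Mor-⊆ f = Mor-ids (All.tabulate (λ p → hyp (f p)))

  Mor-id : ∀ {Δ} {Hs : List (Fm Δ)} → Mor Hs ids Hs
  Mor-id = Mor-⊆ id

  Mor-↑ : ∀ {Δ τ} {Hs : List (Fm Δ)} → Mor (map (wkF {τ = τ}) Hs) ↑ Hs
  Mor-↑ = All.tabulate (λ {H} p → cast (wkF≡subF-↑ H) (hyp (∈-map⁺ wkF p)))

  Mor-map-wkF⁻ : ∀ {Δ Δ' τ} {Hs : List (Fm Δ)} {Hs' : List (Fm Δ')} {σ : Sub (τ ∷ Δ) Δ'} →
                 Mor Hs' σ (map wkF Hs) → Mor Hs' (σ ∘s ↑) Hs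
  Mor-map-wkF⁻ {σ = σ} m = All.map (λ {H} d → cast (subF-wkF σ H) d) (All.map⁻ m)

  Mor-map-wkF⁺ : ∀ {Δ Δ' τ} {Hs : List (Fm Δ)} {Hs' : List (Fm Δ')} {σ : Sub (τ ∷ Δ) Δ'} →
                 Mor Hs' (σ ∘s ↑) Hs → Mor Hs' σ (map wkF Hs)
  Mor-map-wkF⁺ {σ = σ} m = All.map⁺ (All.map (λ {H} d → cast (sym (subF-wkF σ H)) d) m)

  hyp₀ : ∀ {Γ} {X : Fm Γ} {Hs} → (X ∷ Hs) ⊢ X
  hyp₀ = hyp (here refl)

  hyp₁ : ∀ {Γ} {X Y : Fm Γ} {Hs} → (Y ∷ X ∷ Hs) ⊢ X
  hyp₁ = hyp (there (here refl))

  cut : ∀ {Γ} {Hs : List (Fm Γ)} {A B} → Hs ⊢ A → (A ∷ Hs) ⊢ B → Hs ⊢ B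
  cut d e = ⇒E (⇒I e) d

  ⊤' : ∀ {Γ} → Fm Γ
  ⊤' = ⊥' ⇒' ⊥'

  ⊤I : ∀ {Γ} {Hs : List (Fm Γ)} → Hs ⊢ ⊤'
  ⊤I = ⇒I hyp₀

  eq-refl : ∀ {Γ ρ} {Hs : List (Fm Γ)} (t : Tm Γ ρ) → Hs ⊢ eq t t
  eq-refl t = ax (inj₁ (refl-ax t))

  leibniz : ∀ {Γ ρ} {Hs : List (Fm Γ)} (B : Fm (ρ ∷ Γ)) → Atomic B → {x y : Tm Γ ρ} →
            Hs ⊢ eq x y → Hs ⊢ B [ x ] → Hs ⊢ B [ y ]
  leibniz B at {x} {y} x≡y d = ⇒E (ax (inj₁ (subst-ax B at x y))) (∧I x≡y d)

  eq-sym : ∀ {Γ ρ} {Hs : List (Fm Γ)} {x y : Tm Γ ρ} → Hs ⊢ eq x y → Hs ⊢ eq y x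
  eq-sym {x = x} {y} x≡y =
    subst (λ u → _ ⊢ eq y u) (single-wkT y x)
      (leibniz (eq (var vz) (wkT x)) (at-eq _ _) x≡y
        (subst (λ u → _ ⊢ eq x u) (sym (single-wkT x x)) (eq-refl x)))

  eq-trans : ∀ {Γ ρ} {Hs : List (Fm Γ)} {x y z : Tm Γ ρ} → Hs ⊢ eq x y → Hs ⊢ eq y z → Hs ⊢ eq x z
  eq-trans {x = x} {y} {z} x≡y y≡z =
    subst (λ u → _ ⊢ eq u z) (single-wkT z x)
      (leibniz (eq (wkT x) (var vz)) (at-eq _ _) y≡z
        (subst (λ u → _ ⊢ eq u y) (sym (single-wkT y x)) x≡y))

  app-congʳ : ∀ {Γ σ τ} {Hs : List (Fm Γ)} (f : Tm Γ (σ ⇒ τ)) {a b : Tm Γ σ} →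
              Hs ⊢ eq a b → Hs ⊢ eq (app f a) (app f b)
  app-congʳ {Hs = Hs} f {a} {b} a≡b =
    subst₂ (λ u v → Hs ⊢ eq u (app v b)) (single-wkT b (app f a)) (single-wkT b f)
      (leibniz (eq (wkT (app f a)) (app (wkT f) (var vz))) (at-eq _ _) a≡b
        (subst₂ (λ u v → Hs ⊢ eq u (app v a)) (sym (single-wkT a (app f a))) (sym (single-wkT a f))
          (eq-refl (app f a))))

  app-congˡ : ∀ {Γ σ τ} {Hs : List (Fm Γ)} {f g : Tm Γ (σ ⇒ τ)} (a : Tm Γ σ) →
              Hs ⊢ eq f g → Hs ⊢ eq (app f a) (app g a)
  app-congˡ {Hs = Hs} {f = f} {g} a f≡g =
    subst₂ (λ u v → Hs ⊢ eq u (app g v)) (single-wkT g (app f a)) (single-wkT g a)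
      (leibniz (eq (wkT (app f a)) (app (var vz) (wkT a))) (at-eq _ _) f≡g
        (subst₂ (λ u v → Hs ⊢ eq u (app f v)) (sym (single-wkT f (app f a))) (sym (single-wkT f a))
          (eq-refl (app f a))))

  app-cong : ∀ {Γ σ τ} {Hs : List (Fm Γ)} {f g : Tm Γ (σ ⇒ τ)} {a b : Tm Γ σ} →
             Hs ⊢ eq f g → Hs ⊢ eq a b → Hs ⊢ eq (app f a) (app g b)
  app-cong {f = f} {b = b} f≡g a≡b = eq-trans (app-congʳ f a≡b) (app-congˡ b f≡g)

  mem-congʳ : ∀ {Γ σ} {Hs : List (Fm Γ)} {w : Tm Γ σ} {X Y : Tm Γ (σ *)} →
              Hs ⊢ mem w X → Hs ⊢ eq X Y → Hs ⊢ mem w Y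
  mem-congʳ {w = w} {X} {Y} w∈X X≡Y =
    subst (λ u → _ ⊢ mem u Y) (single-wkT Y w)
      (leibniz (mem (wkT w) (var vz)) (at-mem _ _) X≡Y
        (subst (λ u → _ ⊢ mem u X) (sym (single-wkT X w)) w∈X))

  mem-∪I : ∀ {Γ σ} {Hs : List (Fm Γ)} {w : Tm Γ σ} {X Y : Tm Γ (σ *)} →
           Hs ⊢ mem w X ∨' mem w Y → Hs ⊢ mem w (app (app (con (cup σ)) X) Y)
  mem-∪I = ⇒E (∧E₂ (ax (inj₁ (cup-ax _ _ _))))

  ∃∈I : ∀ {Γ σ} {Hs : List (Fm Γ)} {W : Tm Γ (σ *)} {P : Fm (σ ∷ Γ)} (t : Tm Γ σ) →
        Hs ⊢ mem t W → Hs ⊢ P [ t ] → Hs ⊢ ∃∈ W P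
  ∃∈I {W = W} {P} t t∈W p =
    ⇒E (∧E₂ (ax (inj₁ (∃∈-ax W P))))
       (∃I t (∧I (subst (λ u → _ ⊢ mem t u) (sym (single-wkT t W)) t∈W) p))

  ∃∈E : ∀ {Γ σ} {Hs : List (Fm Γ)} {W : Tm Γ (σ *)} {P : Fm (σ ∷ Γ)} {C} →
        Hs ⊢ ∃∈ W P → ((mem (var vz) (wkT W) ∧' P) ∷ map wkF Hs) ⊢ wkF C → Hs ⊢ C
  ∃∈E {W = W} {P} d e = ∃E (⇒E (∧E₁ (ax (inj₁ (∃∈-ax W P)))) d) e

  ∀∈I : ∀ {Γ σ} {Hs : List (Fm Γ)} {W : Tm Γ (σ *)} {P : Fm (σ ∷ Γ)} →
        (mem (var vz) (wkT W) ∷ map wkF Hs) ⊢ P → Hs ⊢ ∀∈ W P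
  ∀∈I {W = W} {P} d = ⇒E (∧E₂ (ax (inj₁ (∀∈-ax W P)))) (∀I (⇒I d))

  ∀∈E : ∀ {Γ σ} {Hs : List (Fm Γ)} {W : Tm Γ (σ *)} {P : Fm (σ ∷ Γ)} (t : Tm Γ σ) →
        Hs ⊢ ∀∈ W P → Hs ⊢ mem t W → Hs ⊢ P [ t ]
  ∀∈E {W = W} {P} t d t∈W =
    ⇒E (∀E (⇒E (∧E₁ (ax (inj₁ (∀∈-ax W P)))) d) t)
       (subst (λ u → _ ⊢ mem t u) (sym (single-wkT t W)) t∈W)

  ∃∈I-vz : ∀ {Γ σ} {Hs : List (Fm (σ ∷ Γ))} {W : Tm Γ (σ *)} {P : Fm (σ ∷ Γ)} →
           Hs ⊢ mem (var vz) (wkT W) → Hs ⊢ P → Hs ⊢ wkF (∃∈ W P)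
  ∃∈I-vz {P = P} vz∈W p = ∃∈I (var vz) vz∈W (cast (sym (single-vz-liftR P)) p)

  ∃∈-sng : ∀ {Δ τ} {Hs : List (Fm Δ)} (t : Tm Δ τ) → Hs ⊢ ∃∈ (app (con (sng τ)) t) (eq (var vz) (wkT t))
  ∃∈-sng t = ∃∈I t (⇒E (∧E₂ (ax (inj₁ (sng-ax t t)))) (eq-refl t))
                   (cast (cong (eq t) (sym (single-wkT t t))) (eq-refl t))

  ∃∈-resp-eq : ∀ {Γ σ} {Hs : List (Fm Γ)} {X Y : Tm Γ (σ *)} {P} →
               Hs ⊢ eq X Y → Hs ⊢ ∃∈ X P → Hs ⊢ ∃∈ Y P
  ∃∈-resp-eq X≡Y d = ∃∈E d (∃∈I-vz (mem-congʳ (∧E₁ hyp₀) (weaken (⊢-wkF X≡Y))) (∧E₂ hyp₀))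

module CombinatoryAbstraction (L : Language) (T : Syntax.Fm L [] → Set) where
  open Language L
  open Syntax L
  open Derivations L T

  -- Bracket abstraction, with Σ and Π in the roles of the combinators S and K.
  lam : ∀ {Δ τ ρ} → Tm (τ ∷ Δ) ρ → Tm Δ (τ ⇒ ρ)
  lam {τ = τ}     (var vz)      = app (app (con (Σc τ (τ ⇒ τ) τ)) (con (Πc τ (τ ⇒ τ)))) (con (Πc τ τ))
  lam {τ = τ} {ρ} (var (vs x))  = app (con (Πc ρ τ)) (var x)
  lam {τ = τ} {ρ} (con k)       = app (con (Πc ρ τ)) (con k)
  lam {τ = τ} {ρ} (app {σ} t u) = app (app (con (Σc τ σ ρ)) (lam t)) (lam u)

  lam-β : ∀ {Δ Δ' τ ρ} {Hs : List (Fm Δ')} (θ : Sub Δ Δ') (t : Tm (τ ∷ Δ) ρ) (u : Tm Δ' τ) →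
          Hs ⊢ eq (app (subT θ (lam t)) u) (subT (u ▸ θ) t)
  lam-β θ (var vz)     u = eq-trans (ax (inj₁ (Σ-ax _ _ u))) (ax (inj₁ (Π-ax u _)))
  lam-β θ (var (vs x)) u = ax (inj₁ (Π-ax _ u))
  lam-β θ (con k)      u = ax (inj₁ (Π-ax _ u))
  lam-β θ (app t t')   u = eq-trans (ax (inj₁ (Σ-ax _ _ u))) (app-cong (lam-β θ t u) (lam-β θ t' u))

  mem-⋃I : ∀ {Δ τ τ₂} {Ks : List (Fm (τ₂ ∷ τ ∷ Δ))} {W : Tm Δ (τ *)} (U : Tm (τ ∷ Δ) (τ₂ *)) →
           Ks ⊢ mem (var (vs vz)) (wkT (wkT W)) → Ks ⊢ mem (var vz) (wkT U) →
           Ks ⊢ mem (var vz) (wkT (wkT (app (app (con (bigcup τ τ₂)) W) (lam U))))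
  mem-⋃I {W = W} U w∈W w₂∈U =
    ⇒E (ax (inj₁ (bigcup-ax (wkT (wkT W)) (wkT (wkT (lam U))) (var (vs vz)) (var vz))))
       (∧I w∈W (mem-congʳ w₂∈U (eq-sym U≡)))
    where
    U≡ : _ ⊢ eq (app (wkT (wkT (lam U))) (var (vs vz))) (wkT U)
    U≡ = cast (cong₂ eq (cong (λ q → app q (var (vs vz))) (sym (wkT²≡subT-↑² (lam U)))) (subT-vs-vz▸↑² U))
              (lam-β ↑² U (var (vs vz)))

  -- The constant symbol of L is used only here, to give ⊩-explode a bound for ∃ from ⊥.
  inhabitant : ∀ {Δ} (τ : Ty) → Tm Δ τ
  inhabitant {Δ} G   = subst (λ n → Tm Δ (arityTy n)) aConstArity (con (fun aConst))
  inhabitant (σ ⇒ τ) = app (con (Πc τ σ)) (inhabitant τ)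
  inhabitant (τ *)   = app (con (sng τ)) (inhabitant τ)

module Forcing (L : Language) (T : Syntax.Fm L [] → Set) where
  open Syntax L
  open Derivations L T public
  open CombinatoryAbstraction L T public

  -- Hs ⊩ A ⟨ θ ⟩: the world (Δ , Hs) forces A with its free variables instantiated by θ.
  -- The world (Δ' , Hs') is accessible from it along any σ with Mor Hs' σ Hs.
  infix 3 _⊩_⟨_⟩
  _⊩_⟨_⟩ : ∀ {Γ Δ} → List (Fm Δ) → Fm Γ → Sub Γ Δ → Set
  Hs ⊩ A@⊥'       ⟨ θ ⟩ = Hs ⊢ subF θ A
  Hs ⊩ A@(eq _ _)  ⟨ θ ⟩ = Hs ⊢ subF θ A
  Hs ⊩ A@(mem _ _) ⟨ θ ⟩ = Hs ⊢ subF θ A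
  Hs ⊩ A@(rel _ _) ⟨ θ ⟩ = Hs ⊢ subF θ A
  _⊩_⟨_⟩ {Δ = Δ} Hs (A ∨' B) θ =
    Σ (Fm Δ) λ P → Σ (Fm Δ) λ Q → (Hs ⊢ P ∨' Q) × (P ∷ Hs) ⊩ A ⟨ θ ⟩ × (Q ∷ Hs) ⊩ B ⟨ θ ⟩
  Hs ⊩ A ∧' B ⟨ θ ⟩ = Hs ⊩ A ⟨ θ ⟩ × Hs ⊩ B ⟨ θ ⟩
  _⊩_⟨_⟩ {Δ = Δ} Hs (A ⇒' B) θ = ∀ {Δ'} {Hs' : List (Fm Δ')} (σ : Sub Δ Δ') → Mor Hs' σ Hs →
    Hs' ⊩ A ⟨ σ ∘s θ ⟩ → Hs' ⊩ B ⟨ σ ∘s θ ⟩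
  _⊩_⟨_⟩ {Δ = Δ} Hs (∀' τ A) θ = ∀ {Δ'} {Hs' : List (Fm Δ')} (σ : Sub Δ Δ') → Mor Hs' σ Hs →
    (t : Tm Δ' τ) → Hs' ⊩ A ⟨ t ▸ (σ ∘s θ) ⟩
  _⊩_⟨_⟩ {Δ = Δ} Hs (∃' τ A) θ =
    Σ (Tm Δ (τ *)) λ W → Σ (Fm (τ ∷ Δ)) λ P → (Hs ⊢ ∃∈ W P) × (P ∷ map wkF Hs) ⊩ A ⟨ liftS θ ⟩
  _⊩_⟨_⟩ {Δ = Δ} Hs (∀∈ {τ} t A) θ = ∀ {Δ'} {Hs' : List (Fm Δ')} (σ : Sub Δ Δ') → Mor Hs' σ Hs →
    (s : Tm Δ' τ) → Hs' ⊢ mem s (subT (σ ∘s θ) t) → Hs' ⊩ A ⟨ s ▸ (σ ∘s θ) ⟩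
  _⊩_⟨_⟩ {Δ = Δ} Hs (∃∈ {τ} t A) θ =
    Σ (Fm (τ ∷ Δ)) λ P → (Hs ⊢ ∃∈ (subT θ t) P) × (P ∷ map wkF Hs) ⊩ A ⟨ liftS θ ⟩

  ⊩-≐ : ∀ {Γ Δ} {Hs : List (Fm Δ)} (A : Fm Γ) {θ θ' : Sub Γ Δ} → θ ≐ θ' → Hs ⊩ A ⟨ θ ⟩ → Hs ⊩ A ⟨ θ' ⟩
  ⊩-≐ A@⊥'       h d = cast (subF-≐ h A) d
  ⊩-≐ A@(eq _ _)  h d = cast (subF-≐ h A) d
  ⊩-≐ A@(mem _ _) h d = cast (subF-≐ h A) d
  ⊩-≐ A@(rel _ _) h d = cast (subF-≐ h A) d
  ⊩-≐ (A ∨' B) h (P , Q , d , a , b) = P , Q , d , ⊩-≐ A h a , ⊩-≐ B h b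
  ⊩-≐ (A ∧' B) h (a , b) = ⊩-≐ A h a , ⊩-≐ B h b
  ⊩-≐ (A ⇒' B) h f σ m a = ⊩-≐ B (∘s-≐ σ h) (f σ m (⊩-≐ A (≐-sym (∘s-≐ σ h)) a))
  ⊩-≐ (∀' τ A) h f σ m t = ⊩-≐ A (▸-≐ t (∘s-≐ σ h)) (f σ m t)
  ⊩-≐ (∃' τ A) h (W , P , d , a) = W , P , d , ⊩-≐ A (liftS-≐ h) a
  ⊩-≐ (∀∈ t A) h f σ m s s∈t =
    ⊩-≐ A (▸-≐ s (∘s-≐ σ h)) (f σ m s (subst (λ u → _ ⊢ mem s u) (sym (subT-≐ (∘s-≐ σ h) t)) s∈t))
  ⊩-≐ (∃∈ t A) h (P , d , a) = P , subst (λ u → _ ⊢ ∃∈ u P) (subT-≐ h t) d , ⊩-≐ A (liftS-≐ h) a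

  ⊩-mono : ∀ {Γ Δ Δ'} {Hs : List (Fm Δ)} {Hs' : List (Fm Δ')} (A : Fm Γ) {θ : Sub Γ Δ} (σ : Sub Δ Δ') →
           Mor Hs' σ Hs → Hs ⊩ A ⟨ θ ⟩ → Hs' ⊩ A ⟨ σ ∘s θ ⟩
  ⊩-mono A@⊥'       {θ} σ m d = cast (subF-∘ σ θ A) (⊢-subF σ m d)
  ⊩-mono A@(eq _ _)  {θ} σ m d = cast (subF-∘ σ θ A) (⊢-subF σ m d)
  ⊩-mono A@(mem _ _) {θ} σ m d = cast (subF-∘ σ θ A) (⊢-subF σ m d)
  ⊩-mono A@(rel _ _) {θ} σ m d = cast (subF-∘ σ θ A) (⊢-subF σ m d)
  ⊩-mono (A ∨' B) σ m (P , Q , d , a , b) =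
    subF σ P , subF σ Q , ⊢-subF σ m d , ⊩-mono A σ (Mor-∷ m) a , ⊩-mono B σ (Mor-∷ m) b
  ⊩-mono (A ∧' B) σ m (a , b) = ⊩-mono A σ m a , ⊩-mono B σ m b
  ⊩-mono (A ⇒' B) {θ} σ m f σ' m' a =
    ⊩-≐ B (∘s-assoc σ' σ θ) (f (σ' ∘s σ) (Mor-∘ m m') (⊩-≐ A (≐-sym (∘s-assoc σ' σ θ)) a))
  ⊩-mono (∀' τ A) {θ} σ m f σ' m' t = ⊩-≐ A (▸-≐ t (∘s-assoc σ' σ θ)) (f (σ' ∘s σ) (Mor-∘ m m') t)
  ⊩-mono (∃' τ A) {θ} σ m (W , P , d , a) =
    subT σ W , subF (liftS σ) P , ⊢-subF σ m d ,
    ⊩-≐ A (liftS-∘ σ θ) (⊩-mono A (liftS σ) (Mor-∷ (Mor-liftS m)) a)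
  ⊩-mono (∀∈ t A) {θ} σ m f σ' m' s s∈t =
    ⊩-≐ A (▸-≐ s (∘s-assoc σ' σ θ))
      (f (σ' ∘s σ) (Mor-∘ m m') s (subst (λ u → _ ⊢ mem s u) (sym (subT-≐ (∘s-assoc σ' σ θ) t)) s∈t))
  ⊩-mono (∃∈ t A) {θ} σ m (P , d , a) =
    subF (liftS σ) P , subst (λ u → _ ⊢ ∃∈ u _) (subT-∘ σ θ t) (⊢-subF σ m d) ,
    ⊩-≐ A (liftS-∘ σ θ) (⊩-mono A (liftS σ) (Mor-∷ (Mor-liftS m)) a)

  ⊩-hyps : ∀ {Γ Δ} {Hs Hs' : List (Fm Δ)} (A : Fm Γ) {θ : Sub Γ Δ} →
           All (Hs' ⊢_) Hs → Hs ⊩ A ⟨ θ ⟩ → Hs' ⊩ A ⟨ θ ⟩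
  ⊩-hyps A {θ} ds a = ⊩-≐ A (ids-∘s θ) (⊩-mono A ids (Mor-ids ds) a)

  ⊩-⊆ : ∀ {Γ Δ} {Hs Hs' : List (Fm Δ)} (A : Fm Γ) {θ : Sub Γ Δ} → Hs ⊆ Hs' → Hs ⊩ A ⟨ θ ⟩ → Hs' ⊩ A ⟨ θ ⟩
  ⊩-⊆ A {θ} f a = ⊩-≐ A (ids-∘s θ) (⊩-mono A ids (Mor-⊆ f) a)

  reflect : ∀ {Γ Δ} {Hs : List (Fm Δ)} {A : Fm Γ} (θ : Sub Γ Δ) → ExFree A → Hs ⊢ subF θ A → Hs ⊩ A ⟨ θ ⟩
  reify   : ∀ {Γ Δ} {Hs : List (Fm Δ)} {A : Fm Γ} (θ : Sub Γ Δ) → ExFree A → Hs ⊩ A ⟨ θ ⟩ → Hs ⊢ subF θ A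

  reflect θ (ef-at at-⊥)          d = d
  reflect θ (ef-at (at-eq t q))   d = d
  reflect θ (ef-at (at-mem t q))  d = d
  reflect θ (ef-at (at-rel R ts)) d = d
  reflect {A = A ∨' B} θ (ef-∨ eA eB) d = subF θ A , subF θ B , d , reflect θ eA hyp₀ , reflect θ eB hyp₀
  reflect θ (ef-∧ eA eB) d = reflect θ eA (∧E₁ d) , reflect θ eB (∧E₂ d)
  reflect {A = A ⇒' B} θ (ef-⇒ eA eB) d σ m a =
    reflect (σ ∘s θ) eB (⇒E (cast (subF-∘ σ θ (A ⇒' B)) (⊢-subF σ m d)) (reify (σ ∘s θ) eA a))
  reflect {A = ∀' τ A} θ (ef-∀ eA) d σ m t =
    reflect (t ▸ (σ ∘s θ)) eA (cast (subF-∘-lift-single σ θ A t) (∀E (⊢-subF σ m d) t))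
  reflect {A = ∀∈ b A} θ (ef-∀∈ eA) d σ m s s∈b =
    reflect (s ▸ (σ ∘s θ)) eA (cast (subF-∘-lift-single σ θ A s)
      (∀∈E s (⊢-subF σ m d) (subst (λ u → _ ⊢ mem s u) (sym (subT-∘ σ θ b)) s∈b)))
  reflect {A = ∃∈ b A} θ (ef-∃∈ eA) d = subF (liftS θ) A , d , reflect (liftS θ) eA hyp₀

  reify θ (ef-at at-⊥)          d = d
  reify θ (ef-at (at-eq t q))   d = d
  reify θ (ef-at (at-mem t q))  d = d
  reify θ (ef-at (at-rel R ts)) d = d
  reify θ (ef-∨ eA eB) (P , Q , d , a , b) = ∨E d (∨I₁ (reify θ eA a)) (∨I₂ (reify θ eB b))
  reify θ (ef-∧ eA eB) (a , b) = ∧I (reify θ eA a) (reify θ eB b)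
  reify {A = A ⇒' B} θ (ef-⇒ eA eB) f =
    ⇒I (cast (subF-≐ (ids-∘s θ) B)
      (reify (ids ∘s θ) eB (f ids (Mor-⊆ there) (⊩-≐ A (≐-sym (ids-∘s θ)) (reflect θ eA hyp₀)))))
  reify {A = ∀' τ A} θ (ef-∀ eA) f = ∀I (cast (subF-≐ (vz▸↑∘s θ) A) (reify _ eA (f ↑ Mor-↑ (var vz))))
  reify {A = ∀∈ b A} θ (ef-∀∈ eA) f =
    ∀∈I (cast (subF-≐ (vz▸↑∘s θ) A) (reify _ eA (f ↑ (Mor-weaken Mor-↑) (var vz) (hyp (here vz∈b)))))
    where
    vz∈b : mem (var vz) (subT (↑ ∘s θ) b) ≡ mem (var vz) (wkT (subT θ b))
    vz∈b = cong (mem (var vz)) (sym (trans (wkT≡subT-↑ (subT θ b)) (subT-∘ ↑ θ b)))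
  reify {A = ∃∈ b A} θ (ef-∃∈ eA) (P , d , a) =
    ∃∈E d (∃∈I-vz (∧E₁ hyp₀) (cut (∧E₂ hyp₀) (⊢-⊆ (∷⁺ʳ _ there) (reify (liftS θ) eA a))))

  ⊩-explode : ∀ {Γ Δ} {Hs : List (Fm Δ)} (A : Fm Γ) {θ : Sub Γ Δ} → Hs ⊢ ⊥' → Hs ⊩ A ⟨ θ ⟩
  ⊩-explode ⊥'        d = ⊥E d
  ⊩-explode (eq _ _)  d = ⊥E d
  ⊩-explode (mem _ _) d = ⊥E d
  ⊩-explode (rel _ _) d = ⊥E d
  ⊩-explode (A ∨' B)  d = ⊥' , ⊥' , ∨I₁ d , ⊩-explode A hyp₀ , ⊩-explode B hyp₀
  ⊩-explode (A ∧' B)  d = ⊩-explode A d , ⊩-explode B d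
  ⊩-explode (A ⇒' B)  d σ m a = ⊩-explode B (⊢-subF σ m d)
  ⊩-explode (∀' τ A)  d σ m t = ⊩-explode A (⊢-subF σ m d)
  ⊩-explode (∃' τ A)  d = inhabitant (τ *) , ⊥' , ⊥E d , ⊩-explode A hyp₀
  ⊩-explode (∀∈ t A)  d σ m s s∈t = ⊩-explode A (⊢-subF σ m d)
  ⊩-explode (∃∈ t A)  d = ⊥' , ⊥E d , ⊩-explode A hyp₀

  ▸-∘s-liftS : ∀ {Γ Γ' Δ Δ' τ} (t : Tm Δ' τ) (σ : Sub Δ Δ') (θ : Sub Γ' Δ) (s : Sub Γ Γ') →
               (t ▸ (σ ∘s θ)) ∘s liftS s ≐ t ▸ (σ ∘s (θ ∘s s))
  ▸-∘s-liftS t σ θ s vz     = refl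
  ▸-∘s-liftS t σ θ s (vs x) = trans (subT-wkT (t ▸ (σ ∘s θ)) (s x)) (sym (subT-∘ σ θ (s x)))

  ⊩-subF⁻ : ∀ {Γ Γ' Δ} {Hs : List (Fm Δ)} (A : Fm Γ) (s : Sub Γ Γ') (θ : Sub Γ' Δ) →
            Hs ⊩ subF s A ⟨ θ ⟩ → Hs ⊩ A ⟨ θ ∘s s ⟩
  ⊩-subF⁺ : ∀ {Γ Γ' Δ} {Hs : List (Fm Δ)} (A : Fm Γ) (s : Sub Γ Γ') (θ : Sub Γ' Δ) →
            Hs ⊩ A ⟨ θ ∘s s ⟩ → Hs ⊩ subF s A ⟨ θ ⟩

  ⊩-subF⁻ A@⊥'       s θ d = cast (subF-∘ θ s A) d
  ⊩-subF⁻ A@(eq _ _)  s θ d = cast (subF-∘ θ s A) d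
  ⊩-subF⁻ A@(mem _ _) s θ d = cast (subF-∘ θ s A) d
  ⊩-subF⁻ A@(rel _ _) s θ d = cast (subF-∘ θ s A) d
  ⊩-subF⁻ (A ∨' B) s θ (P , Q , d , a , b) = P , Q , d , ⊩-subF⁻ A s θ a , ⊩-subF⁻ B s θ b
  ⊩-subF⁻ (A ∧' B) s θ (a , b) = ⊩-subF⁻ A s θ a , ⊩-subF⁻ B s θ b
  ⊩-subF⁻ (A ⇒' B) s θ f σ m a =
    ⊩-≐ B (∘s-assoc σ θ s)
      (⊩-subF⁻ B s (σ ∘s θ) (f σ m (⊩-subF⁺ A s (σ ∘s θ) (⊩-≐ A (≐-sym (∘s-assoc σ θ s)) a))))
  ⊩-subF⁻ (∀' τ A) s θ f σ m t =
    ⊩-≐ A (▸-∘s-liftS t σ θ s) (⊩-subF⁻ A (liftS s) (t ▸ (σ ∘s θ)) (f σ m t))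
  ⊩-subF⁻ (∃' τ A) s θ (W , P , d , a) =
    W , P , d , ⊩-≐ A (liftS-∘ θ s) (⊩-subF⁻ A (liftS s) (liftS θ) a)
  ⊩-subF⁻ (∀∈ b A) s θ f σ m t t∈b =
    ⊩-≐ A (▸-∘s-liftS t σ θ s) (⊩-subF⁻ A (liftS s) (t ▸ (σ ∘s θ))
      (f σ m t (subst (λ u → _ ⊢ mem t u) (subT-∘-assoc σ θ s b) t∈b)))
  ⊩-subF⁻ (∃∈ b A) s θ (P , d , a) =
    P , subst (λ u → _ ⊢ ∃∈ u P) (subT-∘ θ s b) d , ⊩-≐ A (liftS-∘ θ s) (⊩-subF⁻ A (liftS s) (liftS θ) a)

  ⊩-subF⁺ A@⊥'       s θ d = cast (sym (subF-∘ θ s A)) d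
  ⊩-subF⁺ A@(eq _ _)  s θ d = cast (sym (subF-∘ θ s A)) d
  ⊩-subF⁺ A@(mem _ _) s θ d = cast (sym (subF-∘ θ s A)) d
  ⊩-subF⁺ A@(rel _ _) s θ d = cast (sym (subF-∘ θ s A)) d
  ⊩-subF⁺ (A ∨' B) s θ (P , Q , d , a , b) = P , Q , d , ⊩-subF⁺ A s θ a , ⊩-subF⁺ B s θ b
  ⊩-subF⁺ (A ∧' B) s θ (a , b) = ⊩-subF⁺ A s θ a , ⊩-subF⁺ B s θ b
  ⊩-subF⁺ (A ⇒' B) s θ f σ m a =
    ⊩-subF⁺ B s (σ ∘s θ)
      (⊩-≐ B (≐-sym (∘s-assoc σ θ s)) (f σ m (⊩-≐ A (∘s-assoc σ θ s) (⊩-subF⁻ A s (σ ∘s θ) a))))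
  ⊩-subF⁺ (∀' τ A) s θ f σ m t =
    ⊩-subF⁺ A (liftS s) (t ▸ (σ ∘s θ)) (⊩-≐ A (≐-sym (▸-∘s-liftS t σ θ s)) (f σ m t))
  ⊩-subF⁺ (∃' τ A) s θ (W , P , d , a) =
    W , P , d , ⊩-subF⁺ A (liftS s) (liftS θ) (⊩-≐ A (≐-sym (liftS-∘ θ s)) a)
  ⊩-subF⁺ (∀∈ b A) s θ f σ m t t∈b =
    ⊩-subF⁺ A (liftS s) (t ▸ (σ ∘s θ)) (⊩-≐ A (≐-sym (▸-∘s-liftS t σ θ s))
      (f σ m t (subst (λ u → _ ⊢ mem t u) (sym (subT-∘-assoc σ θ s b)) t∈b)))
  ⊩-subF⁺ (∃∈ b A) s θ (P , d , a) =
    P , subst (λ u → _ ⊢ ∃∈ u P) (sym (subT-∘ θ s b)) d ,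
    ⊩-subF⁺ A (liftS s) (liftS θ) (⊩-≐ A (≐-sym (liftS-∘ θ s)) a)

  -- u and v are substituted for the head variable of τ ∷ Δ₀, which φ may use anywhere;
  -- under a binder φ becomes liftS-behind φ, which keeps that variable at the head.
  ⊢-subT-cong : ∀ {Γ Δ Δ₀ τ ρ} {Hs : List (Fm Δ)} (φ : Sub Γ (τ ∷ Δ₀)) (θ : Sub Δ₀ Δ) {u v : Tm Δ τ}
                (b : Tm Γ ρ) → Hs ⊢ eq u v → Hs ⊢ eq (subT ((u ▸ θ) ∘s φ) b) (subT ((v ▸ θ) ∘s φ) b)
  ⊢-subT-cong φ θ {u} {v} b u≡v =
    cast (cong₂ eq (single-wkT v b[u]) (instance≡ v))
      (leibniz (eq (wkT b[u]) (subT (liftS θ) (subT φ b))) (at-eq _ _) u≡v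
        (cast (cong₂ eq (sym (single-wkT u b[u])) (sym (instance≡ u))) (eq-refl b[u])))
    where
    b[u] = subT ((u ▸ θ) ∘s φ) b
    instance≡ : ∀ w → subT (single w) (subT (liftS θ) (subT φ b)) ≡ subT ((w ▸ θ) ∘s φ) b
    instance≡ w = trans (subT-liftS-single θ (subT φ b) w) (subT-∘ (w ▸ θ) φ b)

  ⊢-atomic-cong : ∀ {Γ Δ Δ₀ τ} {Hs : List (Fm Δ)} {A : Fm Γ} → Atomic A →
                  (φ : Sub Γ (τ ∷ Δ₀)) (θ : Sub Δ₀ Δ) {u v : Tm Δ τ} → Hs ⊢ eq u v →
                  Hs ⊢ subF ((u ▸ θ) ∘s φ) A → Hs ⊢ subF ((v ▸ θ) ∘s φ) A
  ⊢-atomic-cong {A = A} at φ θ u≡v d =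
    cast (instance≡ _) (leibniz B (atomic-subF (liftS θ) (atomic-subF φ at)) u≡v (cast (sym (instance≡ _)) d))
    where
    B = subF (liftS θ) (subF φ A)
    instance≡ : ∀ w → B [ w ] ≡ subF ((w ▸ θ) ∘s φ) A
    instance≡ w = trans (subF-liftS-single θ (subF φ A) w) (subF-∘ (w ▸ θ) φ A)

  liftS-behind : ∀ {Γ Δ₀ τ τ'} → Sub Γ (τ ∷ Δ₀) → Sub (τ' ∷ Γ) (τ ∷ τ' ∷ Δ₀)
  liftS-behind φ vz     = var (vs vz)
  liftS-behind φ (vs x) = renT (liftR vs) (φ x)

  ∘s-▸-∘s : ∀ {Γ Δ Δ' Δ₀ τ} (φ : Sub Γ (τ ∷ Δ₀)) (θ : Sub Δ₀ Δ) (σ : Sub Δ Δ') (w : Tm Δ τ) →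
            σ ∘s ((w ▸ θ) ∘s φ) ≐ (subT σ w ▸ (σ ∘s θ)) ∘s φ
  ∘s-▸-∘s φ θ σ w x = trans (subT-∘ σ (w ▸ θ) (φ x)) (subT-≐ σ∘s▸ (φ x))
    where
    σ∘s▸ : σ ∘s (w ▸ θ) ≐ subT σ w ▸ (σ ∘s θ)
    σ∘s▸ vz     = refl
    σ∘s▸ (vs x) = refl

  ▸-liftS-behind : ∀ {Γ Δ Δ' Δ₀ τ τ'} (φ : Sub Γ (τ ∷ Δ₀)) (θ : Sub Δ₀ Δ) (σ : Sub Δ Δ')
                   (t : Tm Δ' τ') (w : Tm Δ τ) →
                   t ▸ (σ ∘s ((w ▸ θ) ∘s φ)) ≐ (subT σ w ▸ (t ▸ (σ ∘s θ))) ∘s liftS-behind φ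
  ▸-liftS-behind φ θ σ t w vz     = refl
  ▸-liftS-behind φ θ σ t w (vs x) = begin
    subT σ (subT (w ▸ θ) (φ x))                             ≡⟨ ∘s-▸-∘s φ θ σ w x ⟩
    subT (subT σ w ▸ (σ ∘s θ)) (φ x)                        ≡⟨ subT-≐ skip (φ x) ⟨
    subT (ηt ∘s toSub (liftR vs)) (φ x)                     ≡⟨ subT-∘ ηt (toSub (liftR vs)) (φ x) ⟨
    subT ηt (subT (toSub (liftR vs)) (φ x))                 ≡⟨ cong (subT ηt) (renT≡subT (liftR vs) (φ x)) ⟨
    subT ηt (renT (liftR vs) (φ x))                         ∎
    where
    ηt = subT σ w ▸ (t ▸ (σ ∘s θ))
    skip : ηt ∘s toSub (liftR vs) ≐ subT σ w ▸ (σ ∘s θ)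
    skip vz     = refl
    skip (vs y) = refl

  liftS-liftS-behind : ∀ {Γ Δ Δ₀ τ τ'} (φ : Sub Γ (τ ∷ Δ₀)) (θ : Sub Δ₀ Δ) (w : Tm Δ τ) →
                       liftS {τ = τ'} ((w ▸ θ) ∘s φ) ≐ (subT ↑ w ▸ (var vz ▸ (↑ ∘s θ))) ∘s liftS-behind φ
  liftS-liftS-behind φ θ w x =
    trans (sym (vz▸↑∘s ((w ▸ θ) ∘s φ) x)) (▸-liftS-behind φ θ ↑ (var vz) w x)

  ⊩-resp-eq : ∀ {Γ Δ Δ₀ τ} {Hs : List (Fm Δ)} (A : Fm Γ) (φ : Sub Γ (τ ∷ Δ₀)) (θ : Sub Δ₀ Δ)
              (u v : Tm Δ τ) → Hs ⊢ eq u v → Hs ⊩ A ⟨ (u ▸ θ) ∘s φ ⟩ → Hs ⊩ A ⟨ (v ▸ θ) ∘s φ ⟩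
  ⊩-resp-eq A@⊥'          φ θ u v u≡v d = ⊢-atomic-cong at-⊥ φ θ u≡v d
  ⊩-resp-eq A@(eq t q)    φ θ u v u≡v d = ⊢-atomic-cong (at-eq t q) φ θ u≡v d
  ⊩-resp-eq A@(mem t q)   φ θ u v u≡v d = ⊢-atomic-cong (at-mem t q) φ θ u≡v d
  ⊩-resp-eq A@(rel R ts)  φ θ u v u≡v d = ⊢-atomic-cong (at-rel R ts) φ θ u≡v d
  ⊩-resp-eq (A ∨' B) φ θ u v u≡v (P , Q , d , a , b) =
    P , Q , d , ⊩-resp-eq A φ θ u v (weaken u≡v) a , ⊩-resp-eq B φ θ u v (weaken u≡v) b
  ⊩-resp-eq (A ∧' B) φ θ u v u≡v (a , b) = ⊩-resp-eq A φ θ u v u≡v a , ⊩-resp-eq B φ θ u v u≡v b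
  ⊩-resp-eq (A ⇒' B) φ θ u v u≡v f σ m a =
    ⊩-≐ B (≐-sym (∘s-▸-∘s φ θ σ v))
      (⊩-resp-eq B φ (σ ∘s θ) (subT σ u) (subT σ v) σu≡σv
        (⊩-≐ B (∘s-▸-∘s φ θ σ u) (f σ m (⊩-≐ A (≐-sym (∘s-▸-∘s φ θ σ u))
          (⊩-resp-eq A φ (σ ∘s θ) (subT σ v) (subT σ u) (eq-sym σu≡σv) (⊩-≐ A (∘s-▸-∘s φ θ σ v) a))))))
    where σu≡σv = ⊢-subF σ m u≡v
  ⊩-resp-eq (∀' τ A) φ θ u v u≡v f σ m t =
    ⊩-≐ A (≐-sym (▸-liftS-behind φ θ σ t v))
      (⊩-resp-eq A (liftS-behind φ) (t ▸ (σ ∘s θ)) (subT σ u) (subT σ v) (⊢-subF σ m u≡v)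
        (⊩-≐ A (▸-liftS-behind φ θ σ t u) (f σ m t)))
  ⊩-resp-eq (∃' τ A) φ θ u v u≡v (W , P , d , a) =
    W , P , d , ⊩-≐ A (≐-sym (liftS-liftS-behind φ θ v))
      (⊩-resp-eq A (liftS-behind φ) (var vz ▸ (↑ ∘s θ)) (subT ↑ u) (subT ↑ v)
        (weaken (⊢-subF ↑ Mor-↑ u≡v)) (⊩-≐ A (liftS-liftS-behind φ θ u) a))
  ⊩-resp-eq (∀∈ b A) φ θ u v u≡v f σ m s s∈b =
    ⊩-≐ A (≐-sym (▸-liftS-behind φ θ σ s v))
      (⊩-resp-eq A (liftS-behind φ) (s ▸ (σ ∘s θ)) (subT σ u) (subT σ v) (⊢-subF σ m u≡v)
        (⊩-≐ A (▸-liftS-behind φ θ σ s u) (f σ m s s∈b[u])))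
    where
    s∈b[u] = cast (cong (mem s) (sym (subT-≐ (∘s-▸-∘s φ θ σ u) b)))
               (mem-congʳ (cast (cong (mem s) (subT-≐ (∘s-▸-∘s φ θ σ v) b)) s∈b)
                          (⊢-subT-cong φ (σ ∘s θ) b (eq-sym (⊢-subF σ m u≡v))))
  ⊩-resp-eq (∃∈ b A) φ θ u v u≡v (P , d , a) =
    P , ∃∈-resp-eq (⊢-subT-cong φ θ b u≡v) d ,
    ⊩-≐ A (≐-sym (liftS-liftS-behind φ θ v))
      (⊩-resp-eq A (liftS-behind φ) (var vz ▸ (↑ ∘s θ)) (subT ↑ u) (subT ↑ v)
        (weaken (⊢-subF ↑ Mor-↑ u≡v)) (⊩-≐ A (liftS-liftS-behind φ θ u) a))

  ∧-unpair : ∀ {Δ} {P Q Y : Fm Δ} {Hs} → All (((P ∧' Q) ∷ Y ∷ Hs) ⊢_) (Q ∷ P ∷ Hs)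
  ∧-unpair = ∧E₂ hyp₀ ∷ ∧E₁ hyp₀ ∷ All.tabulate (λ p → hyp (there (there p)))

  -- Bounds of the two cases are merged with ∪, selection formulas with ∨.
  ⊩-∨-glue : ∀ {Γ Δ} {Hs : List (Fm Δ)} (C : Fm Γ) (θ : Sub Γ Δ) {P Q : Fm Δ} → Hs ⊢ P ∨' Q →
             (P ∷ Hs) ⊩ C ⟨ θ ⟩ → (Q ∷ Hs) ⊩ C ⟨ θ ⟩ → Hs ⊩ C ⟨ θ ⟩
  ⊩-∨-glue ⊥'        θ d a b = ∨E d a b
  ⊩-∨-glue (eq _ _)  θ d a b = ∨E d a b
  ⊩-∨-glue (mem _ _) θ d a b = ∨E d a b
  ⊩-∨-glue (rel _ _) θ d a b = ∨E d a b
  ⊩-∨-glue (C₁ ∨' C₂) θ {P} {Q} d (P₁ , Q₁ , d₁ , a₁ , b₁) (P₂ , Q₂ , d₂ , a₂ , b₂) =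
    (P ∧' P₁) ∨' (Q ∧' P₂) , (P ∧' Q₁) ∨' (Q ∧' Q₂) ,
    ∨E d (∨E d₁ (∨I₁ (∨I₁ (∧I hyp₁ hyp₀))) (∨I₂ (∨I₁ (∧I hyp₁ hyp₀))))
         (∨E d₂ (∨I₁ (∨I₂ (∧I hyp₁ hyp₀))) (∨I₂ (∨I₂ (∧I hyp₁ hyp₀)))) ,
    ⊩-∨-glue C₁ θ hyp₀ (⊩-hyps C₁ ∧-unpair a₁) (⊩-hyps C₁ ∧-unpair a₂) ,
    ⊩-∨-glue C₂ θ hyp₀ (⊩-hyps C₂ ∧-unpair b₁) (⊩-hyps C₂ ∧-unpair b₂)
  ⊩-∨-glue (A ∧' B) θ d (a₁ , b₁) (a₂ , b₂) = ⊩-∨-glue A θ d a₁ a₂ , ⊩-∨-glue B θ d b₁ b₂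
  ⊩-∨-glue (A ⇒' B) θ d f g σ m a =
    ⊩-∨-glue B (σ ∘s θ) (⊢-subF σ m d) (f σ (Mor-∷ m) (⊩-⊆ A there a)) (g σ (Mor-∷ m) (⊩-⊆ A there a))
  ⊩-∨-glue (∀' τ A) θ d f g σ m t =
    ⊩-∨-glue A (t ▸ (σ ∘s θ)) (⊢-subF σ m d) (f σ (Mor-∷ m) t) (g σ (Mor-∷ m) t)
  ⊩-∨-glue (∀∈ b A) θ d f g σ m s s∈b =
    ⊩-∨-glue A (s ▸ (σ ∘s θ)) (⊢-subF σ m d) (f σ (Mor-∷ m) s (weaken s∈b)) (g σ (Mor-∷ m) s (weaken s∈b))
  ⊩-∨-glue (∃' τ C) θ {P} {Q} d (W₁ , P₁ , d₁ , a₁) (W₂ , P₂ , d₂ , a₂) =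
    app (app (con (cup τ)) W₁) W₂ , (wkF P ∧' P₁) ∨' (wkF Q ∧' P₂) ,
    ∨E d (∃∈E d₁ (∃∈I-vz (mem-∪I (∨I₁ (∧E₁ hyp₀))) (∨I₁ (∧I hyp₁ (∧E₂ hyp₀)))))
         (∃∈E d₂ (∃∈I-vz (mem-∪I (∨I₂ (∧E₁ hyp₀))) (∨I₂ (∧I hyp₁ (∧E₂ hyp₀))))) ,
    ⊩-∨-glue C (liftS θ) hyp₀ (⊩-hyps C ∧-unpair a₁) (⊩-hyps C ∧-unpair a₂)
  ⊩-∨-glue (∃∈ b C) θ {P} {Q} d (P₁ , d₁ , a₁) (P₂ , d₂ , a₂) =
    (wkF P ∧' P₁) ∨' (wkF Q ∧' P₂) ,
    ∨E d (∃∈E d₁ (∃∈I-vz (∧E₁ hyp₀) (∨I₁ (∧I hyp₁ (∧E₂ hyp₀)))))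
         (∃∈E d₂ (∃∈I-vz (∧E₁ hyp₀) (∨I₂ (∧I hyp₁ (∧E₂ hyp₀))))) ,
    ⊩-∨-glue C (liftS θ) hyp₀ (⊩-hyps C ∧-unpair a₁) (⊩-hyps C ∧-unpair a₂)

  -- In  ∃w∈W (P w ∧ ∃w₂∈V₁(w) P₁(w,w₂))  the two bounded quantifiers are exchanged to
  -- ∃w₂∈V ∃w∈W (P w ∧ P₁(w,w₂)); joint-selector is the matrix of the result.
  joint-selector : ∀ {Δ τ τ₂} → Fm (τ ∷ Δ) → Fm (τ₂ ∷ τ ∷ Δ) → Fm (τ ∷ τ₂ ∷ Δ)
  joint-selector P P₁ = renF (liftR vs) P ∧' subF swap P₁

  ∃∈-exchange : ∀ {Δ τ τ₂} {Hs : List (Fm Δ)} {W : Tm Δ (τ *)} {P : Fm (τ ∷ Δ)}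
                {V₁ : Tm (τ ∷ Δ) (τ₂ *)} {P₁ : Fm (τ₂ ∷ τ ∷ Δ)} →
                Hs ⊢ ∃∈ W P → (P ∷ map wkF Hs) ⊢ ∃∈ V₁ P₁ → (V : Tm Δ (τ₂ *)) →
                ((mem (var vz) (wkT V₁) ∧' P₁) ∷ wkF (mem (var vz) (wkT W) ∧' P) ∷ map wkF (map wkF Hs))
                  ⊢ mem (var vz) (wkT (wkT V)) →
                Hs ⊢ ∃∈ V (∃∈ (wkT W) (joint-selector P P₁))
  ∃∈-exchange {W = W} {P} {V₁} {P₁} d d₁ V V₁⊆V =
    ∃∈E d (∃∈E (cut (∧E₂ hyp₀) (⊢-⊆ (∷⁺ʳ _ there) d₁))
      (∃∈I-vz {W = wkT V} {P = renF (liftR vs) (∃∈ (wkT W) (joint-selector P P₁))} V₁⊆V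
        (∃∈I {W = renT (liftR vs) (wkT W)} {P = renF (liftR (liftR vs)) (joint-selector P P₁)} (var (vs vz))
          (cast (cong (mem (var (vs vz))) (sym (renT-liftR-wkT vs W))) (∧E₁ hyp₁))
          (∧I (cast P≡ (∧E₂ hyp₁)) (cast P₁≡ (∧E₂ hyp₀))))))
    where
    P≡ : wkF P ≡ renF (liftR (liftR vs)) (renF (liftR vs) P) [ var (vs vz) ]
    P≡ = begin
      wkF P
        ≡⟨ renF≡subF vs P ⟩
      subF ↑ P
        ≡⟨ subF-∘∘-≐ _ _ _ (λ { vz → refl ; (vs x) → refl }) P ⟨
      subF (single (var (vs vz))) (subF (toSub (liftR (liftR vs))) (subF (toSub (liftR vs)) P))
        ≡⟨ cong _[ var (vs vz) ] (trans (renF≡subF _ _) (cong (subF _) (renF≡subF _ P))) ⟨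
      renF (liftR (liftR vs)) (renF (liftR vs) P) [ var (vs vz) ]
        ∎
    P₁≡ : P₁ ≡ renF (liftR (liftR vs)) (subF swap P₁) [ var (vs vz) ]
    P₁≡ = sym (begin
      renF (liftR (liftR vs)) (subF swap P₁) [ var (vs vz) ]
        ≡⟨ cong _[ var (vs vz) ] (renF≡subF _ _) ⟩
      subF (single (var (vs vz))) (subF (toSub (liftR (liftR vs))) (subF swap P₁))
        ≡⟨ subF-∘∘-≐ _ _ _ (λ { vz → refl ; (vs vz) → refl ; (vs (vs x)) → refl }) P₁ ⟩
      subF ids P₁
        ≡⟨ subF-ids P₁ ⟩
      P₁
        ∎)

  Mor-swap : ∀ {Δ τ τ₂} {X Y : Fm (τ ∷ τ₂ ∷ Δ)} (Hs : List (Fm Δ)) →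
             Mor (X ∷ Y ∷ map wkF (map wkF Hs)) (swap {τ = τ} {τ₂ = τ₂}) (map wkF (map wkF Hs))
  Mor-swap []       = []
  Mor-swap (H ∷ Hs) = cast (sym swap-wkF²) (hyp (there (there (here refl))))
                    ∷ All.map (⊢-⊆ (∷⁺ʳ _ (∷⁺ʳ _ there))) (Mor-swap Hs)
    where
    swap-wkF² : subF swap (wkF (wkF H)) ≡ wkF (wkF H)
    swap-wkF² = begin
      subF swap (wkF (wkF H))     ≡⟨ subF-wkF swap (wkF H) ⟩
      subF (swap ∘s ↑) (wkF H)    ≡⟨ subF-wkF (swap ∘s ↑) H ⟩
      subF (↑ ∘s ↑) H             ≡⟨ subF-wkF ↑ H ⟨
      subF ↑ (wkF H)              ≡⟨ wkF≡subF-↑ (wkF H) ⟨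
      wkF (wkF H)                 ∎

  ⊩-swap : ∀ {Γ Δ τ τ₂} {Hs : List (Fm Δ)} (C : Fm (τ₂ ∷ Γ)) (θ : Sub Γ Δ)
           {P : Fm (τ ∷ Δ)} {P₁ : Fm (τ₂ ∷ τ ∷ Δ)} {X : Fm (τ₂ ∷ Δ)} →
           (P₁ ∷ map wkF (P ∷ map wkF Hs)) ⊩ C ⟨ liftS (↑ ∘s θ) ⟩ →
           (joint-selector P P₁ ∷ map wkF (X ∷ map wkF Hs)) ⊩ C ⟨ ↑ ∘s liftS θ ⟩
  ⊩-swap {Hs = Hs} C θ {P} {P₁} a₁ =
    ⊩-≐ C swap∘liftS (⊩-mono C swap (∧E₂ hyp₀ ∷ cast wkP≡ (∧E₁ hyp₀) ∷ Mor-swap Hs) a₁)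
    where
    wkP≡ : renF (liftR vs) P ≡ subF swap (wkF P)
    wkP≡ = trans (renF≡subF _ P)
             (trans (subF-≐ (λ { vz → refl ; (vs x) → refl }) P) (sym (subF-wkF swap P)))
    swap∘liftS : swap ∘s liftS (↑ ∘s θ) ≐ ↑ ∘s liftS θ
    swap∘liftS vz     = refl
    swap∘liftS (vs x) = begin
      subT swap (wkT (subT ↑ (θ x)))      ≡⟨ cong (subT swap) (wkT≡subT-↑ (subT ↑ (θ x))) ⟩
      subT swap (subT ↑ (subT ↑ (θ x)))   ≡⟨ subT-∘∘-≐ swap ↑ ↑ (λ y → refl) (θ x) ⟩
      subT ↑² (θ x)                       ≡⟨ subT-wkT ↑ (θ x) ⟨
      subT ↑ (wkT (θ x))                  ∎

  liftS-∘s-↑∘s : ∀ {Γ Δ Δ' τ} (σ : Sub Δ Δ') (θ : Sub Γ Δ) → liftS {τ = τ} σ ∘s (↑ ∘s θ) ≐ ↑ ∘s (σ ∘s θ)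
  liftS-∘s-↑∘s σ θ x = begin
    subT (liftS σ) (subT ↑ (θ x))   ≡⟨ cong (subT (liftS σ)) (wkT≡subT-↑ (θ x)) ⟨
    subT (liftS σ) (wkT (θ x))      ≡⟨ liftS-wkT σ (θ x) ⟩
    wkT (subT σ (θ x))              ≡⟨ wkT≡subT-↑ _ ⟩
    subT ↑ (subT σ (θ x))           ∎

  ⊢-∃∈-glue : ∀ {Γ Δ τ} {Hs : List (Fm Δ)} (C : Fm Γ) (θ : Sub Γ Δ) {W : Tm Δ (τ *)} {P : Fm (τ ∷ Δ)} →
              Hs ⊢ ∃∈ W P → (P ∷ map wkF Hs) ⊢ subF (↑ ∘s θ) C → Hs ⊢ subF θ C
  ⊢-∃∈-glue C θ d c = ∃∈E d (cut (∧E₂ hyp₀) (⊢-⊆ (∷⁺ʳ _ there) (cast (sym (wkF-subF θ C)) c)))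

  ▸-liftS-∘s-↑∘s : ∀ {Γ Δ Δ' τ τ'} (σ : Sub Δ Δ') (θ : Sub Γ Δ) (t : Tm Δ' τ') →
        subT ↑ t ▸ (liftS {τ = τ} σ ∘s (↑ ∘s θ)) ≐ ↑ ∘s (t ▸ (σ ∘s θ))
  ▸-liftS-∘s-↑∘s σ θ t vz     = refl
  ▸-liftS-∘s-↑∘s σ θ t (vs x) = liftS-∘s-↑∘s σ θ x

  -- Bounds V₁(w) depending on the witness w ∈ W are collected into ⋃ W (λw.V₁).
  ⊩-∃∈-glue : ∀ {Γ Δ τ} {Hs : List (Fm Δ)} (C : Fm Γ) (θ : Sub Γ Δ) {W : Tm Δ (τ *)} {P : Fm (τ ∷ Δ)} →
              Hs ⊢ ∃∈ W P → (P ∷ map wkF Hs) ⊩ C ⟨ ↑ ∘s θ ⟩ → Hs ⊩ C ⟨ θ ⟩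
  ⊩-∃∈-glue C@⊥'       θ d a = ⊢-∃∈-glue C θ d a
  ⊩-∃∈-glue C@(eq _ _)  θ d a = ⊢-∃∈-glue C θ d a
  ⊩-∃∈-glue C@(mem _ _) θ d a = ⊢-∃∈-glue C θ d a
  ⊩-∃∈-glue C@(rel _ _) θ d a = ⊢-∃∈-glue C θ d a
  ⊩-∃∈-glue (A ∧' B) θ d (a , b) = ⊩-∃∈-glue A θ d a , ⊩-∃∈-glue B θ d b
  ⊩-∃∈-glue (A ⇒' B) θ d f σ m a =
    ⊩-∃∈-glue B (σ ∘s θ) (⊢-subF σ m d)
      (⊩-≐ B (liftS-∘s-↑∘s σ θ)
        (f (liftS σ) (Mor-∷ (Mor-liftS m))
          (⊩-≐ A (≐-sym (liftS-∘s-↑∘s σ θ)) (⊩-mono A ↑ (Mor-weaken Mor-↑) a))))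
  ⊩-∃∈-glue (∀' τ' A) θ d f σ m t =
    ⊩-∃∈-glue A (t ▸ (σ ∘s θ)) (⊢-subF σ m d)
      (⊩-≐ A (▸-liftS-∘s-↑∘s σ θ t) (f (liftS σ) (Mor-∷ (Mor-liftS m)) (subT ↑ t)))
  ⊩-∃∈-glue (∀∈ b A) θ d f σ m s s∈b =
    ⊩-∃∈-glue A (s ▸ (σ ∘s θ)) (⊢-subF σ m d)
      (⊩-≐ A (▸-liftS-∘s-↑∘s σ θ s) (f (liftS σ) (Mor-∷ (Mor-liftS m)) (subT ↑ s) ↑s∈b))
    where
    ↑s∈b = cast (cong (mem _) (trans (subT-∘ ↑ (σ ∘s θ) b) (subT-≐ (≐-sym (liftS-∘s-↑∘s σ θ)) b)))
                (weaken (⊢-subF ↑ Mor-↑ s∈b))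
  ⊩-∃∈-glue (C₁ ∨' C₂) θ {W} {P} d (P₁ , Q₁ , d₁ , a₁ , b₁) =
    ∃∈ W (P ∧' P₁) , ∃∈ W (P ∧' Q₁) ,
    ∃∈E d (∨E (cut (∧E₂ hyp₀) (⊢-⊆ (∷⁺ʳ _ there) d₁))
              (∨I₁ (∃∈I-vz (∧E₁ hyp₁) (∧I (∧E₂ hyp₁) hyp₀)))
              (∨I₂ (∃∈I-vz (∧E₁ hyp₁) (∧I (∧E₂ hyp₁) hyp₀)))) ,
    ⊩-∃∈-glue C₁ θ hyp₀ (⊩-hyps C₁ ∧-unpair a₁) , ⊩-∃∈-glue C₂ θ hyp₀ (⊩-hyps C₂ ∧-unpair b₁)
  ⊩-∃∈-glue (∃' τ₂ C) θ {W} {P} d (W₁ , P₁ , d₁ , a₁) =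
    V , ∃∈ (wkT W) (joint-selector P P₁) , ∃∈-exchange d d₁ V V₁⊆V ,
    ⊩-∃∈-glue C (liftS θ) hyp₀ (⊩-swap C θ a₁)
    where
    V = app (app (con (bigcup _ τ₂)) W) (lam W₁)
    V₁⊆V = mem-⋃I W₁ (∧E₁ hyp₁) (∧E₁ hyp₀)
  ⊩-∃∈-glue (∃∈ b C) θ {W} {P} d (P₁ , d₁ , a₁) =
    ∃∈ (wkT W) (joint-selector P P₁) ,
    ∃∈-exchange d d₁ (subT θ b)
      (cast (cong (λ q → mem (var vz) (wkT q)) (trans (sym (subT-∘ ↑ θ b)) (sym (wkT≡subT-↑ _)))) (∧E₁ hyp₀)) ,
    ⊩-∃∈-glue C (liftS θ) hyp₀ (⊩-swap C θ a₁)

module Soundness (L : Language) (T : Syntax.Fm L [] → Set) (T-exFree : ∀ B → T B → Syntax.ExFree L B) where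
  open Syntax L
  open Forcing L T public

  ⊩-renF⁻ : ∀ {Γ Γ' Δ} {Hs : List (Fm Δ)} (A : Fm Γ) (ρ : Ren Γ Γ') (θ : Sub Γ' Δ) →
            Hs ⊩ renF ρ A ⟨ θ ⟩ → Hs ⊩ A ⟨ θ ∘s toSub ρ ⟩
  ⊩-renF⁻ {Hs = Hs} A ρ θ a = ⊩-subF⁻ A (toSub ρ) θ (subst (λ X → Hs ⊩ X ⟨ θ ⟩) (renF≡subF ρ A) a)

  ⊩-renF⁺ : ∀ {Γ Γ' Δ} {Hs : List (Fm Δ)} (A : Fm Γ) (ρ : Ren Γ Γ') (θ : Sub Γ' Δ) →
            Hs ⊩ A ⟨ θ ∘s toSub ρ ⟩ → Hs ⊩ renF ρ A ⟨ θ ⟩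
  ⊩-renF⁺ {Hs = Hs} A ρ θ a = subst (λ X → Hs ⊩ X ⟨ θ ⟩) (sym (renF≡subF ρ A)) (⊩-subF⁺ A (toSub ρ) θ a)

  ⊩-wkF⁺ : ∀ {Γ Δ τ} {Hs : List (Fm Δ)} (H : Fm Γ) (θ : Sub Γ Δ) (t : Tm Δ τ) →
           Hs ⊩ H ⟨ θ ⟩ → Hs ⊩ wkF H ⟨ t ▸ θ ⟩
  ⊩-wkF⁺ H θ t = ⊩-renF⁺ H vs (t ▸ θ)

  ⊩-ILAx-exFree : ∀ {Γ Δ} {Hs : List (Fm Δ)} {A : Fm Γ} → ILAx Γ A → ExFree A → (θ : Sub Γ Δ) → Hs ⊩ A ⟨ θ ⟩
  ⊩-ILAx-exFree a eA θ = reflect θ eA (ax (axiom-subF θ (inj₁ a)))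

  ⊩-ILAx : ∀ {Γ Δ} {Hs : List (Fm Δ)} {A : Fm Γ} → ILAx Γ A → (θ : Sub Γ Δ) → Hs ⊩ A ⟨ θ ⟩
  ⊩-ILAx (∀∈-ax t A) θ = to , from
    where
    to : _ ⊩ ∀∈ t A ⇒' ∀' _ (mem (var vz) (wkT t) ⇒' A) ⟨ θ ⟩
    to σ m f σ' m' s σ'' m'' s∈t =
      ⊩-≐ A σ''-▸ (f (σ'' ∘s σ') (Mor-∘ m' m'') (subT σ'' s) (cast (cong (mem _) t≡) s∈t))
      where
      η = σ' ∘s (σ ∘s θ)
      t≡ = trans (subT-wkT (σ'' ∘s (s ▸ η)) t) (subT-≐ (≐-sym (∘s-assoc σ'' σ' (σ ∘s θ))) t)
      σ''-▸ : subT σ'' s ▸ ((σ'' ∘s σ') ∘s (σ ∘s θ)) ≐ σ'' ∘s (s ▸ η)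
      σ''-▸ vz     = refl
      σ''-▸ (vs x) = ∘s-assoc σ'' σ' (σ ∘s θ) x
    from : _ ⊩ ∀' _ (mem (var vz) (wkT t) ⇒' A) ⇒' ∀∈ t A ⟨ θ ⟩
    from σ m g σ' m' s s∈t =
      ⊩-≐ A (ids-∘s (s ▸ η)) (g σ' m' s ids Mor-id
        (cast (cong₂ mem (sym (subT-ids s)) (sym t≡)) s∈t))
      where
      η = σ' ∘s (σ ∘s θ)
      t≡ = trans (subT-≐ (ids-∘s (s ▸ η)) (wkT t)) (subT-wkT (s ▸ η) t)
  ⊩-ILAx (∃∈-ax t A) θ = to , from
    where
    to : _ ⊩ ∃∈ t A ⇒' ∃' _ (mem (var vz) (wkT t) ∧' A) ⟨ θ ⟩
    to σ m (P , d , a) =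
      subT (σ ∘s θ) t , mem (var vz) (wkT (subT (σ ∘s θ) t)) ∧' P , ∃∈E d (∃∈I-vz (∧E₁ hyp₀) hyp₀) ,
      cast (cong (mem _) (sym (liftS-wkT (σ ∘s θ) t))) (∧E₁ hyp₀) ,
      ⊩-hyps A (∧E₂ hyp₀ ∷ All.tabulate (hyp ∘′ there)) a
    from : _ ⊩ ∃' _ (mem (var vz) (wkT t) ∧' A) ⇒' ∃∈ t A ⟨ θ ⟩
    from σ m (W , P , d , vz∈t , a) =
      P , ∃∈E d (∃∈I-vz (cut (∧E₂ hyp₀) (⊢-⊆ (∷⁺ʳ _ there) (cast (cong (mem _) (liftS-wkT (σ ∘s θ) t)) vz∈t)))
                        (∧E₂ hyp₀)) , a
  ⊩-ILAx a@(refl-ax x)     θ = ⊩-ILAx-exFree a (ef-at (at-eq _ _)) θ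
  ⊩-ILAx a@(subst-ax A at x y) θ =
    ⊩-ILAx-exFree a (ef-⇒ (ef-∧ (ef-at (at-eq x y)) (ef-at (atomic-subF (single x) at)))
                          (ef-at (atomic-subF (single y) at))) θ
  ⊩-ILAx a@(Σ-ax x y z)    θ = ⊩-ILAx-exFree a (ef-at (at-eq _ _)) θ
  ⊩-ILAx a@(Π-ax x y)      θ = ⊩-ILAx-exFree a (ef-at (at-eq _ _)) θ
  ⊩-ILAx a@(sng-ax w x)    θ =
    ⊩-ILAx-exFree a (ef-∧ (ef-⇒ (ef-at (at-mem _ _)) (ef-at (at-eq _ _)))
                          (ef-⇒ (ef-at (at-eq _ _)) (ef-at (at-mem _ _)))) θ
  ⊩-ILAx a@(cup-ax w x y)  θ =
    ⊩-ILAx-exFree a (ef-∧ (ef-⇒ (ef-at (at-mem _ _)) (ef-∨ (ef-at (at-mem _ _)) (ef-at (at-mem _ _))))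
                          (ef-⇒ (ef-∨ (ef-at (at-mem _ _)) (ef-at (at-mem _ _))) (ef-at (at-mem _ _)))) θ
  ⊩-ILAx a@(bigcup-ax x y z w) θ =
    ⊩-ILAx-exFree a (ef-⇒ (ef-∧ (ef-at (at-mem _ _)) (ef-at (at-mem _ _))) (ef-at (at-mem _ _))) θ
  ⊩-ILAx a@(bigcup-sng-ax x y)   θ = ⊩-ILAx-exFree a (ef-at (at-eq _ _)) θ
  ⊩-ILAx a@(bigcup-cup-ax x y z) θ = ⊩-ILAx-exFree a (ef-at (at-eq _ _)) θ

  -- The bound W(x) for ∃y A(x,y) yields the choice function λx.W(x), bounded by its singleton.
  ⊩-ACAx : ∀ {Γ Δ} {Hs : List (Fm Δ)} {A : Fm Γ} → ACAx Γ A → (θ : Sub Γ Δ) → Hs ⊩ A ⟨ θ ⟩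
  ⊩-ACAx (ac {ρ = ρ} A) θ {Hs' = Hs'} σ m f with f ↑ Mor-↑ (var vz)
  ... | W , P , d , a = app (con (sng _)) (lam W) , eq (var vz) (wkT (lam W)) , ∃∈-sng (lam W) , choice
    where
    η = σ ∘s θ
    choice : (eq (var vz) (wkT (lam W)) ∷ map wkF Hs')
               ⊩ ∀' ρ (∃∈ (app (var (vs vz)) (var vz)) (renF (liftR (liftR vs)) A)) ⟨ liftS η ⟩
    choice {Hs' = Ks} σ₁ m₁ s =
      subF (liftS σ₂) P , ∃∈-resp-eq W≡ (⊢-subF σ₂ m₂ d) ,
      ⊩-renF⁺ A (liftR (liftR vs)) _ (⊩-≐ A ≐-renF (⊩-mono A (liftS σ₂) (Mor-∷ (Mor-liftS m₂)) a))
      where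
      σ₂ = s ▸ (σ₁ ∘s ↑)
      m₂ : Mor Ks σ₂ (map wkF Hs')
      m₂ = Mor-map-wkF⁺ (Mor-map-wkF⁻ (All.tail m₁))
      f≡lamW : Ks ⊢ eq (σ₁ vz) (subT (σ₁ ∘s ↑) (lam W))
      f≡lamW = cast (cong (eq _) (subT-wkT σ₁ (lam W))) (All.head m₁)
      W≡ : Ks ⊢ eq (subT σ₂ W) (app (σ₁ vz) s)
      W≡ = eq-sym (eq-trans (app-congˡ s f≡lamW) (lam-β (σ₁ ∘s ↑) W s))
      ≐-renF : liftS σ₂ ∘s liftS (var vz ▸ (↑ ∘s η)) ≐ liftS (s ▸ (σ₁ ∘s liftS η)) ∘s toSub (liftR (liftR vs))
      ≐-renF vz          = refl
      ≐-renF (vs vz)     = refl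
      ≐-renF (vs (vs i)) =
        trans (liftS-wkT σ₂ (subT ↑ (η i))) (cong wkT (trans (subT-∘ σ₂ ↑ (η i)) (sym (subT-wkT σ₁ (η i)))))

  -- B is ∃-free, so it can be assumed as a hypothesis (reflect); the bound W for ∃y A(y)
  -- obtained under it becomes the witness w of IP, bounded by {W}.
  ⊩-IPAx : ∀ {Γ Δ} {Hs : List (Fm Δ)} {A : Fm Γ} → IPAx Γ A → (θ : Sub Γ Δ) → Hs ⊩ A ⟨ θ ⟩
  ⊩-IPAx (ip B eB A) θ {Hs' = Hs'} σ m f
    with f ids (Mor-⊆ there) (⊩-≐ B (≐-sym (ids-∘s (σ ∘s θ))) (reflect (σ ∘s θ) eB hyp₀))
  ... | W , P , d , a = app (con (sng _)) W , eq (var vz) (wkT W) , ∃∈-sng W , selected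
    where
    η = σ ∘s θ
    selected : (eq (var vz) (wkT W) ∷ map wkF Hs') ⊩ wkF B ⇒' ∃∈ (var vz) (renF (liftR vs) A) ⟨ liftS η ⟩
    selected {Hs' = Ks} σ₁ m₁ b =
      subF (liftS σ₂) P , ∃∈-resp-eq W≡ (⊢-subF σ₂ m₂ d) ,
      ⊩-renF⁺ A (liftR vs) _ (⊩-≐ A ≐-renF (⊩-mono A (liftS σ₂) (Mor-∷ (Mor-liftS m₂)) a))
      where
      σ₂ = σ₁ ∘s ↑
      B-holds : Ks ⊢ subF σ₂ (subF η B)
      B-holds = cast (trans (subF-≐ (λ x → subT-wkT σ₁ (η x)) B) (sym (subF-∘ σ₂ η B)))
                     (reify _ eB (⊩-renF⁻ B vs (σ₁ ∘s liftS η) b))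
      m₂ : Mor Ks σ₂ (subF η B ∷ Hs')
      m₂ = B-holds ∷ Mor-map-wkF⁻ (All.tail m₁)
      W≡ : Ks ⊢ eq (subT σ₂ W) (σ₁ vz)
      W≡ = eq-sym (cast (cong (eq _) (subT-wkT σ₁ W)) (All.head m₁))
      ≐-renF : liftS σ₂ ∘s liftS (ids ∘s η) ≐ liftS (σ₁ ∘s liftS η) ∘s toSub (liftR vs)
      ≐-renF vz     = refl
      ≐-renF (vs i) =
        trans (liftS-wkT σ₂ (subT ids (η i)))
              (cong wkT (trans (cong (subT σ₂) (subT-ids (η i))) (sym (subT-wkT σ₁ (η i)))))

  ⊩-TAx : ∀ {Γ Δ} {Hs : List (Fm Δ)} {A : Fm Γ} → TAx T Γ A → (θ : Sub Γ Δ) → Hs ⊩ A ⟨ θ ⟩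
  ⊩-TAx (tax {B = B} B∈T) θ =
    ⊩-renF⁺ B emptyR θ (reflect _ (T-exFree B B∈T)
      (cast (trans (cong (subF θ) (renF≡subF emptyR B)) (subF-∘ θ _ B)) (ax (axiom-subF θ (inj₂ (tax B∈T))))))

  ⊩-axiom : ∀ {Γ Δ} {Hs : List (Fm Δ)} {A : Fm Γ} → ((ILAx ⊕ ACAx) ⊕ (IPAx ⊕ TAx T)) Γ A →
            (θ : Sub Γ Δ) → Hs ⊩ A ⟨ θ ⟩
  ⊩-axiom (inj₁ (inj₁ a)) = ⊩-ILAx a
  ⊩-axiom (inj₁ (inj₂ a)) = ⊩-ACAx a
  ⊩-axiom (inj₂ (inj₁ a)) = ⊩-IPAx a
  ⊩-axiom (inj₂ (inj₂ a)) = ⊩-TAx a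

  infix 3 _⊩*_⟨_⟩
  _⊩*_⟨_⟩ : ∀ {Γ Δ} → List (Fm Δ) → List (Fm Γ) → Sub Γ Δ → Set
  Hs ⊩* Hs₁ ⟨ θ ⟩ = All (λ H → Hs ⊩ H ⟨ θ ⟩) Hs₁

  ⊩*-mono : ∀ {Γ Δ Δ'} {Hs : List (Fm Δ)} {Hs' : List (Fm Δ')} {Hs₁ : List (Fm Γ)} {θ : Sub Γ Δ}
            (σ : Sub Δ Δ') → Mor Hs' σ Hs → Hs ⊩* Hs₁ ⟨ θ ⟩ → Hs' ⊩* Hs₁ ⟨ σ ∘s θ ⟩
  ⊩*-mono σ m = All.map (λ {H} → ⊩-mono H σ m)

  ⊩*-weaken : ∀ {Γ Δ} {Hs : List (Fm Δ)} {Hs₁ : List (Fm Γ)} {θ : Sub Γ Δ} {X} →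
              Hs ⊩* Hs₁ ⟨ θ ⟩ → (X ∷ Hs) ⊩* Hs₁ ⟨ θ ⟩
  ⊩*-weaken = All.map (λ {H} → ⊩-⊆ H there)

  ⊩*-wkF : ∀ {Γ Δ τ} {Hs : List (Fm Δ)} {Hs₁ : List (Fm Γ)} (θ : Sub Γ Δ) (t : Tm Δ τ) →
           Hs ⊩* Hs₁ ⟨ θ ⟩ → Hs ⊩* map wkF Hs₁ ⟨ t ▸ θ ⟩
  ⊩*-wkF θ t hs = All.map⁺ (All.map (λ {H} → ⊩-wkF⁺ H θ t) hs)

  soundness : ∀ {Γ} {Hs₁ : List (Fm Γ)} {A} → ((ILAx ⊕ ACAx) ⊕ (IPAx ⊕ TAx T)) ∣ Hs₁ ⊢ A →
              ∀ {Δ} {Hs : List (Fm Δ)} (θ : Sub Γ Δ) → Hs ⊩* Hs₁ ⟨ θ ⟩ → Hs ⊩ A ⟨ θ ⟩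
  soundness (hyp p)   θ hs = All.lookup hs p
  soundness (ax a)    θ hs = ⊩-axiom a θ
  soundness (⊥E {A = A} d) θ hs = ⊩-explode A (soundness d θ hs)
  soundness (∧I d e)  θ hs = soundness d θ hs , soundness e θ hs
  soundness (∧E₁ d)   θ hs = proj₁ (soundness d θ hs)
  soundness (∧E₂ d)   θ hs = proj₂ (soundness d θ hs)
  soundness (∨I₁ {A = A} {B} d) θ hs = ⊤' , ⊥' , ∨I₁ ⊤I , ⊩-⊆ A there (soundness d θ hs) , ⊩-explode B hyp₀
  soundness (∨I₂ {A = A} {B} d) θ hs = ⊥' , ⊤' , ∨I₂ ⊤I , ⊩-explode A hyp₀ , ⊩-⊆ B there (soundness d θ hs)
  soundness (∨E {C = C} d e₁ e₂) θ hs with soundness d θ hs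
  ... | P , Q , P∨Q , a , b =
    ⊩-∨-glue C θ P∨Q (soundness e₁ θ (a ∷ ⊩*-weaken hs)) (soundness e₂ θ (b ∷ ⊩*-weaken hs))
  soundness (⇒I d) θ hs σ m a = soundness d (σ ∘s θ) (a ∷ ⊩*-mono σ m hs)
  soundness (⇒E {A = A} {B} d e) θ hs =
    ⊩-≐ B (ids-∘s θ) (soundness d θ hs ids Mor-id (⊩-≐ A (≐-sym (ids-∘s θ)) (soundness e θ hs)))
  soundness (∀I d) θ hs σ m t = soundness d (t ▸ (σ ∘s θ)) (⊩*-wkF (σ ∘s θ) t (⊩*-mono σ m hs))
  soundness (∀E {A = A} d t) θ hs =
    ⊩-subF⁺ A (single t) θ (⊩-≐ A t▸θ (soundness d θ hs ids Mor-id (subT θ t)))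
    where
    t▸θ : subT θ t ▸ (ids ∘s θ) ≐ θ ∘s single t
    t▸θ vz     = refl
    t▸θ (vs x) = subT-ids (θ x)
  soundness (∃I {A = A} t d) θ hs =
    app (con (sng _)) (subT θ t) , eq (var vz) (wkT (subT θ t)) , ∃∈-sng (subT θ t) ,
    ⊩-≐ A (vz▸↑∘s θ) (⊩-resp-eq A ids (↑ ∘s θ) (subT ↑ (subT θ t)) (var vz) t≡vz (⊩-≐ A ↑∘s-single A[t]))
    where
    A[t] = ⊩-mono A ↑ (Mor-weaken Mor-↑) (⊩-subF⁻ A (single t) θ (soundness d θ hs))
    ↑∘s-single : ↑ ∘s (θ ∘s single t) ≐ (subT ↑ (subT θ t) ▸ (↑ ∘s θ)) ∘s ids
    ↑∘s-single vz     = refl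
    ↑∘s-single (vs x) = refl
    t≡vz : _ ⊢ eq (subT ↑ (subT θ t)) (var vz)
    t≡vz = eq-sym (cast (cong (eq (var vz)) (wkT≡subT-↑ _)) hyp₀)
  soundness (∃E {C = C} d e) θ hs with soundness d θ hs
  ... | W , P , W∋P , a =
    ⊩-∃∈-glue C θ W∋P (⊩-≐ C liftS∘↑ (⊩-renF⁻ C vs (liftS θ) (soundness e (liftS θ) (a ∷ hs'))))
    where
    hs' = All.map (λ {H} → ⊩-≐ H (vz▸↑∘s θ)) (⊩*-wkF (↑ ∘s θ) (var vz) (⊩*-mono ↑ (Mor-weaken Mor-↑) hs))
    liftS∘↑ : liftS θ ∘s toSub vs ≐ ↑ ∘s θ
    liftS∘↑ x = wkT≡subT-↑ (θ x)

module Extraction (L : Language) (T : Syntax.Fm L [] → Set) (T-exFree : ∀ B → T B → Syntax.ExFree L B) where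
  open Syntax L
  open Soundness L T T-exFree public

  ⊩-∀*⁻ : ∀ {Γ Δ} (zs : List Ty) (X : Fm (Γ ,, zs)) (θ : Sub Γ Δ) →
          [] ⊩ ∀* zs X ⟨ θ ⟩ → [] ⊩ X ⟨ liftS* zs θ ⟩
  ⊩-∀*⁻ []       X θ a = a
  ⊩-∀*⁻ (σ ∷ zs) X θ f = ⊩-∀*⁻ zs X (liftS θ) (⊩-≐ (∀* zs X) (vz▸↑∘s θ) (f ↑ [] (var vz)))

  infix 4 _⊆'_
  _⊆'_ : ∀ {Δ τ} → Tm Δ (τ *) → Tm Δ (τ *) → Fm Δ
  U ⊆' V = ∀' _ (mem (var vz) (wkT U) ⇒' mem (var vz) (wkT V))

  data Included {Δ} (Hs : List (Fm Δ)) : ∀ {ws : List Ty} → All (λ w → Tm Δ (w *)) ws →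
                                          All (λ w → Tm Δ (w *)) ws → Set where
    []  : Included Hs [] []
    _∷_ : ∀ {τ ws} {U V : Tm Δ (τ *)} {Us Vs : All (λ w → Tm Δ (w *)) ws} →
          Hs ⊢ U ⊆' V → Included Hs Us Vs → Included Hs (U ∷ Us) (V ∷ Vs)

  Included-wk : ∀ {Δ τ} {Hs : List (Fm Δ)} {X : Fm (τ ∷ Δ)} {ws} {Us Vs : All (λ w → Tm Δ (w *)) ws} →
                Included Hs Us Vs → Included (X ∷ map wkF Hs) (All.map wkT Us) (All.map wkT Vs)
  Included-wk []                         = []
  Included-wk (_∷_ {U = U} {V = V} p ps) =
    cast (cong₂ (λ a b → ∀' _ (mem (var vz) a ⇒' mem (var vz) b)) (renT-liftR-wkT vs U) (renT-liftR-wkT vs V))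
         (weaken (⊢-wkF p))
    ∷ Included-wk ps

  ∃∈*-mono : ∀ {Δ} {Hs : List (Fm Δ)} (ws : List Ty) {Us Vs : All (λ w → Tm Δ (w *)) ws} {X : Fm (Δ ,, ws)} →
             Hs ⊢ ∃∈* ws Us X → Included Hs Us Vs → Hs ⊢ ∃∈* ws Vs X
  ∃∈*-mono []       {[]}     {[]}     d []       = d
  ∃∈*-mono (τ ∷ ws) {U ∷ Us} {V ∷ Vs} {X} d (U⊆V ∷ Us⊆Vs) =
    ∃∈E d (∃∈I-vz {W = V} {P = ∃∈* ws (All.map wkT Vs) X} w∈V (∃∈*-mono ws (∧E₂ hyp₀) (Included-wk Us⊆Vs)))
    where
    w∈V = ⇒E (cast (single-vz-liftR (mem (var vz) (wkT U) ⇒' mem (var vz) (wkT V)))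
                   (∀E (weaken (⊢-wkF U⊆V)) (var vz)))
             (∧E₁ hyp₀)

  -- A bound U(w) for a later witness may depend on an earlier witness w ∈ W; it is
  -- replaced by ⋃ W (λw.U).
  reify-∃* : ∀ {Γ Δ} (ws : List Ty) {Hs : List (Fm Δ)} (A : Fm (Γ ,, ws)) → ExFree A → (θ : Sub Γ Δ) →
             Hs ⊩ ∃* ws A ⟨ θ ⟩ → Σ (All (λ w → Tm Δ (w *)) ws) (λ Us → Hs ⊢ ∃∈* ws Us (subF (liftS* ws θ) A))
  reify-∃* []       A eA θ a = [] , reify θ eA a
  reify-∃* (σ ∷ ws) {Hs} A eA θ (W , P , d , a) with reify-∃* ws A eA (liftS θ) a
  ... | Us , e = W ∷ All.map ⋃W Us ,
                 ∃∈E d (∃∈I-vz (∧E₁ hyp₀) (∃∈*-mono ws (cut (∧E₂ hyp₀) (⊢-⊆ (∷⁺ʳ _ there) e)) (⊆⋃W Us)))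
    where
    ⋃W : ∀ {τ} → Tm (σ ∷ _) (τ *) → Tm _ (τ *)
    ⋃W U = app (app (con (bigcup σ _)) W) (lam U)
    ⊆⋃W : ∀ {ws'} (Us : All (λ w → Tm (σ ∷ _) (w *)) ws') →
          Included ((mem (var vz) (wkT W) ∧' P) ∷ map wkF Hs) Us (All.map wkT (All.map ⋃W Us))
    ⊆⋃W []       = []
    ⊆⋃W (U ∷ Us) = ∀I (⇒I (mem-⋃I U (∧E₁ hyp₁) hyp₀)) ∷ ⊆⋃W Us

  lam* : ∀ {Γ τ} (zs : List Ty) → Tm (Γ ,, zs) τ → Tm Γ (zs ⇒* τ)
  lam* []       U = U
  lam* (σ ∷ zs) U = lam (lam* zs U)

  apps-cong : ∀ {Γ τ} (zs : List Ty) {a b : Tm Γ (zs ⇒* τ)} → [] ⊢ eq a b → [] ⊢ eq (apps zs a) (apps zs b)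
  apps-cong []       a≡b = a≡b
  apps-cong (σ ∷ zs) a≡b = apps-cong zs (app-congˡ (var vz) (⊢-wkF a≡b))

  lam*-β : ∀ {Γ τ} (zs : List Ty) (U : Tm (Γ ,, zs) τ) → [] ⊢ eq (apps zs (lam* zs U)) U
  lam*-β []       U = eq-refl U
  lam*-β (σ ∷ zs) U = eq-trans (apps-cong zs β) (lam*-β zs U)
    where
    V = lam* zs U
    vz▸↑ : var vz ▸ ↑ ≐ ids
    vz▸↑ vz     = refl
    vz▸↑ (vs x) = refl
    β : [] ⊢ eq (app (wkT (lam V)) (var vz)) V
    β = cast (cong₂ eq (cong (λ q → app q (var vz)) (sym (wkT≡subT-↑ (lam V))))
                       (trans (subT-≐ vz▸↑ V) (subT-ids V)))
             (lam-β ↑ V (var vz))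

  ⊆'-lam* : ∀ {τ} (zs : List Ty) (U : Tm ([] ,, zs) (τ *)) → [] ⊢ U ⊆' apps zs (lam* zs U)
  ⊆'-lam* zs U = ∀I (⇒I (mem-congʳ hyp₀ (weaken (⊢-wkF (eq-sym (lam*-β zs U))))))

  ∀I* : ∀ {Γ} (zs : List Ty) {X : Fm (Γ ,, zs)} → [] ⊢ X → [] ⊢ ∀* zs X
  ∀I* []       d = d
  ∀I* (σ ∷ zs) d = ∀I (∀I* zs d)

  Included-lam* : ∀ (zs : List Ty) {ws} (Us : All (λ w → Tm ([] ,, zs) (w *)) ws) →
                  Included [] Us (All.map (apps zs) (All.map (lam* zs) Us))
  Included-lam* zs []       = []
  Included-lam* zs (U ∷ Us) = ⊆'-lam* zs U ∷ Included-lam* zs Us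

  bounds-in-context : (zs ws : List Ty) (A : Fm (([] ,, zs) ,, ws)) → ExFree A →
                      ((ILAx ⊕ ACAx) ⊕ (IPAx ⊕ TAx T)) ∣ [] ⊢ ∀* zs (∃* ws A) →
                      Σ (All (λ w → Tm ([] ,, zs) (w *)) ws) (λ Us → [] ⊢ ∃∈* ws Us A)
  bounds-in-context zs ws A A-exFree d =
    let Us , ⊢∃∈*Us = reify-∃* ws A A-exFree ids forced
    in Us , cast (cong (∃∈* ws Us) (trans (subF-≐ (liftS*-ids ws) A) (subF-ids A))) ⊢∃∈*Us
    where
    forced : [] ⊩ ∃* ws A ⟨ ids ⟩
    forced = ⊩-≐ (∃* ws A) (liftS*-ids zs) (⊩-∀*⁻ zs (∃* ws A) ids (soundness d ids []))

corollary2 : (L : Language) → let open Syntax L in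
  (T : Fm [] → Set) → (∀ B → T B → ExFree B)
  → (zs ws : List Ty) (A : Fm (([] ,, zs) ,, ws)) → ExFree A
  → ((ILAx ⊕ ACAx) ⊕ (IPAx ⊕ TAx T)) ∣ [] ⊢ ∀* zs (∃* ws A)
  → Σ (All (λ w → Tm [] (zs ⇒* (w *))) ws) (λ rs →
      (ILAx ⊕ TAx T) ∣ [] ⊢ ∀* zs (∃∈* ws (All.map (apps zs) rs) A))
corollary2 L T T-exFree zs ws A A-exFree d =
  let Us , ⊢∃∈*Us = bounds-in-context zs ws A A-exFree d
  in All.map (lam* zs) Us , ∀I* zs (∃∈*-mono ws ⊢∃∈*Us (Included-lam* zs Us))
  where open Extraction L T T-exFree
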